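{- Let $\mathbf{G}=(G,*)$ be a groupoid satisfying the identity $(x*y)*z=(x*z)*y$ for all $x,y,z\in G$. If $s,t$ are linear terms such that $P_s^{\mathrm{u}}=P_t^{\mathrm{u}}$, then $s^{\mathbf G}=t^{\mathbf G}$. Consequently, $s^{\mathrm{ac}}_n(\mathbf G)\le n^{n-1}$. Moreover, if equality $s^{\mathrm{ac}}_n(\mathbf G)=n^{n-1}$ holds, then $s_n(\mathbf G)=C_{n-1}$.
   Context: Groupoid terms over variables $x_1,x_2,\dots$ are built recursively from variables by $(s,t)\mapsto(st)$; a term is linear if no variable occurs more than once. A full linear term over $X_n=\{x_1,\dots,x_n\}$ is one in which each of $x_1,\dots,x_n$ occurs exactly once; a bracketing is a full linear term with variables in order $x_1,\dots,x_n$ from left to right. Terms induce term operations on $\mathbf G$. $s^{\mathrm{ac}}_n(\mathbf G)$ (resp. $s_n(\mathbf G)$) is the number of distinct term operations induced by full linear terms (resp. bracketings) over $X_n$; $C_m=\frac{1}{m+1}\binom{2m}{m}$. Every non-variable term $t$ can be uniquely written as $t=((\cdots((x_it_1)t_2)\cdots)t_k)$ with $x_i$ a variable (its leftmost decomposition with factors $t_1,\dots,t_k$). Define the ordered vertex-labeled rooted tree $P_t$ recursively: if $t$ is a variable $x_i$, $P_t$ is a single vertex labeled $x_i$; otherwise $P_t$ has root labeled $x_i$ whose children, in order, are the roots of $P_{t_1},\dots,P_{t_k}$. $P_t^{\mathrm{u}}$ is the same labeled tree with the order of children forgotten; $P_s^{\mathrm u}=P_t^{\mathrm u}$ means they are equal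 as labeled unordered rooted trees. -}

module Defs where

open import Level using (Level)
open import Data.Nat using (ℕ; zero; suc; _+_; _*_; _/_; _≤_)
open import Data.Nat.Combinatorics using (_C_)
open import Data.List using (List; []; _∷_; _++_; [_]; length; upTo)
open import Data.List.Relation.Unary.All using (All)
open import Data.List.Relation.Unary.Any using (Any)
open import Data.List.Relation.Unary.AllPairs using (AllPairs)
open import Data.List.Relation.Unary.Unique.Propositional using (Unique)
open import Data.List.Relation.Binary.Permutation.Propositional using (_↭_)
open import Data.List.Relation.Binary.Permutation.Homogeneous using (Permutation)
open import Data.Product using (Σ; _×_)
open import Relation.Binary.PropositionalEquality using (_≡_)
open import Relation.Nullary using (¬_)
open import Algebra.Bundles using (Magma)

data Term : Set where
  var : ℕ → Term
  _·_ : Term → Term → Term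

infixl 7 _·_

vars : Term → List ℕ
vars (var i) = i ∷ []
vars (s · t) = vars s ++ vars t

Linear : Term → Set
Linear t = Unique (vars t)

FullLinear : ℕ → Term → Set
FullLinear n t = vars t ↭ upTo n

Bracketing : ℕ → Term → Set
Bracketing n t = vars t ≡ upTo n

data Tree : Set where
  node : ℕ → List Tree → Tree

-- P_t.  If s = ((x_i t₁)⋯t_k) then P_s = node i [P_{t₁},…,P_{t_k}], and the
-- leftmost decomposition of (s t) has factors t₁,…,t_k,t; hence:
P : Term → Tree
P (var i) = node i []
P (s · t) with P s
... | node i ts = node i (ts ++ [ P t ])

-- equality of the underlying labelled unordered rooted trees (P^u_s = P^u_t)
data _≅ᵘ_ : Tree → Tree → Set where
  node : ∀ {i ts us} → Permutation _≅ᵘ_ ts us → node i ts ≅ᵘ node i us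

module _ {c ℓ : Level} (G : Magma c ℓ) where
  open Magma G

  RightPermutable : Set (c Level.⊔ ℓ)
  RightPermutable = ∀ x y z → ((x ∙ y) ∙ z) ≈ ((x ∙ z) ∙ y)

  ⟦_⟧ : Term → (ℕ → Carrier) → Carrier
  ⟦ var i ⟧ ρ = ρ i
  ⟦ s · t ⟧ ρ = ⟦ s ⟧ ρ ∙ ⟦ t ⟧ ρ

  _≈ᵒᵖ_ : Term → Term → Set (c Level.⊔ ℓ)
  s ≈ᵒᵖ t = ∀ ρ → ⟦ s ⟧ ρ ≈ ⟦ t ⟧ ρ

  -- "the number of distinct term operations induced by terms satisfying Q is ≤ K":
  -- some ≤ K terms satisfying Q represent all of them
  AtMostOps : ℕ → (Term → Set) → Set (c Level.⊔ ℓ)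
  AtMostOps K Q = Σ (List Term) λ L →
    length L ≤ K × All Q L × (∀ t → Q t → Any (λ r → t ≈ᵒᵖ r) L)

  -- "the number of distinct term operations induced by terms satisfying Q is = K":
  -- K terms satisfying Q inducing pairwise distinct operations and representing all
  ExactlyOps : ℕ → (Term → Set) → Set (c Level.⊔ ℓ)
  ExactlyOps K Q = Σ (List Term) λ L →
    length L ≡ K × All Q L × AllPairs (λ a b → ¬ (a ≈ᵒᵖ b)) L ×
    (∀ t → Q t → Any (λ r → t ≈ᵒᵖ r) L)

Catalan : ℕ → ℕ
Catalan m = ((m + m) C m) / suc m

-- Right permutability (x*y)*z = (x*z)*y lets the factors t₁, …, t_k of a leftmost decomposition
-- ((x_i t₁)⋯)t_k be permuted, so the term operation of t depends only on the unordered tree P^u_t.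
-- With n = m + 1 variables, a full linear term is a labelled rooted tree on n vertices, encoded by
-- its Prüfer code, a word of length m over the vertices: repeatedly cut off the first leaf and record
-- its parent. Decoding puts every leaf back as the first child of its parent, which by right
-- permutability does not change the term operation, so the decodings of the n^m words represent all
-- operations. If there are exactly n^m operations, the decodings of distinct words induce distinct
-- operations. Distinct bracketings have distinct codes, because a term whose variables increase from
-- left to right is determined by the edges of its tree; hence the C_m bracketings stay distinct.
{-# OPTIONS --safe #-}
module Submission where

open import Defs
open import Level using (Level; 0ℓ; _⊔_)
open import Data.Nat using (ℕ; zero; suc; pred; _+_; _*_; _/_; _^_; _≤_; _<_; _≟_; s≤s; z≤n)
open import Data.Nat.Properties
  using (+-suc; +-comm; +-assoc; +-identityʳ; *-zeroʳ; *-identityˡ; *-identityʳ; *-distribˡ-+; +-cancelʳ-≡;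
         m≤m+n; m+n∸m≡n; suc-injective; ≤-refl; ≤-trans; ≤-reflexive; <-≤-trans; <-irrefl; <-asym; <⇒≱)
open import Data.Nat.Combinatorics using (_C_; nCk+nC[k+1]≡[n+1]C[k+1]; nCk≡nC[n∸k]; nC1≡n)
open import Data.Nat.DivMod using (m*n/n≡m)
open import Data.Nat.ListAction using (sum)
open import Data.Nat.Tactic.RingSolver using (solve-∀)
open import Data.Maybe using (just; nothing)
open import Data.List using (List; []; _∷_; _++_; [_]; length; map; concatMap; upTo; applyUpTo; filter; find; cartesianProductWith)
open import Data.List.Properties
  using (length-map; length-++; length-upTo; ++-assoc; ++-identityʳ; ∷-injective; ∷-injectiveˡ; ∷-injectiveʳ;
         filter-++; filter-all; filter-accept; filter-reject; filter-notAll; ≡-dec)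
open import Data.List.Relation.Unary.All as All using (All; []; _∷_)
import Data.List.Relation.Unary.All.Properties as All
open import Data.List.Relation.Unary.Any using (Any; here; there; any?)
import Data.List.Relation.Unary.Any.Properties as Any
open import Data.List.Relation.Unary.AllPairs as AllPairs using (AllPairs; []; _∷_)
import Data.List.Relation.Unary.AllPairs.Properties as AllPairs
open import Data.List.Relation.Unary.Unique.Propositional using (Unique)
import Data.List.Relation.Unary.Unique.Propositional.Properties as Unique
open import Data.List.Membership.Propositional using (_∈_; _∉_; lose) renaming (find to ∈-find)
open import Data.List.Membership.Propositional.Properties using (∈-map⁺; ∈-map⁻; ∈-++⁺ˡ; ∈-++⁺ʳ; ∈-++⁻; ∈-filter⁺; ∈-filter⁻)
open import Data.List.Membership.DecPropositional _≟_ using (_∈?_)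
open import Data.List.Relation.Binary.Disjoint.Propositional using (Disjoint)
open import Data.List.Relation.Binary.Pointwise using (Pointwise; []; _∷_)
open import Data.List.Relation.Binary.Permutation.Homogeneous as Perm using (Permutation)
open import Data.List.Relation.Binary.Permutation.Propositional
  using (_↭_; ↭-refl; ↭-sym; ↭-trans; ↭-prep; ↭-swap; ↭-reflexive; ↭⇒↭ₛ; module PermutationReasoning)
open import Data.List.Relation.Binary.Permutation.Propositional.Properties using (∈-resp-↭; ↭-length; ↭-singleton-inv; filter-↭)
import Data.List.Relation.Binary.Permutation.Setoid.Properties as PermSetoid
open import Data.Product using (∃-syntax; _×_; _,_; proj₁; proj₂)
open import Data.Sum using (_⊎_; inj₁; inj₂; [_,_]′; map₂)
open import Data.Empty using (⊥; ⊥-elim)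
open import Function using (_∘_)
open import Algebra.Bundles using (Magma)
open import Relation.Binary.Bundles using (Setoid)
import Relation.Binary.Reasoning.Setoid as SetoidReasoning
open import Relation.Binary.PropositionalEquality hiding ([_])
open import Relation.Nullary using (¬_; Dec; yes; no)
open import Relation.Nullary.Decidable using (map′; _×-dec_; ¬?)
open import Relation.Unary using (Decidable)


Unique-++⁻ˡ : ∀ {A : Set} (xs : List A) {ys} → Unique (xs ++ ys) → Unique xs
Unique-++⁻ˡ []       _           = []
Unique-++⁻ˡ (x ∷ xs) (x∉ ∷ uxs) = All.++⁻ˡ xs x∉ ∷ Unique-++⁻ˡ xs uxs

Unique-++⁻ʳ : ∀ {A : Set} (xs : List A) {ys} → Unique (xs ++ ys) → Unique ys
Unique-++⁻ʳ []       u         = u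
Unique-++⁻ʳ (x ∷ xs) (_ ∷ uxs) = Unique-++⁻ʳ xs uxs

Unique-++⇒disjoint : ∀ {A : Set} (xs : List A) {ys v} → Unique (xs ++ ys) → v ∈ xs → v ∈ ys → ⊥
Unique-++⇒disjoint (x ∷ xs) (x∉ ∷ _)   (here refl) v∈ys = All.lookup (All.++⁻ʳ xs x∉) v∈ys refl
Unique-++⇒disjoint (x ∷ xs) (_ ∷ uxs) (there v∈xs) v∈ys = Unique-++⇒disjoint xs uxs v∈xs v∈ys

AllPairs-++⁻ : ∀ {A : Set} {R : A → A → Set} xs {ys} → AllPairs R (xs ++ ys) →
               AllPairs R xs × AllPairs R ys × (∀ {x y} → x ∈ xs → y ∈ ys → R x y)
AllPairs-++⁻ []       rys = [] , rys , λ ()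
AllPairs-++⁻ (x ∷ xs) (rx ∷ rxys) with rxs , rys , across ← AllPairs-++⁻ xs rxys =
  All.++⁻ˡ xs rx ∷ rxs , rys , λ { (here refl) y∈ → All.lookup (All.++⁻ʳ xs rx) y∈ ; (there x∈) y∈ → across x∈ y∈ }

++-cancel-at : ∀ {A : Set} {h : A} xs₁ xs₂ {ys₁ ys₂} → xs₁ ++ h ∷ ys₁ ≡ xs₂ ++ h ∷ ys₂ → h ∉ xs₁ → h ∉ xs₂ →
               xs₁ ≡ xs₂ × ys₁ ≡ ys₂
++-cancel-at []        []        refl _  _  = refl , refl
++-cancel-at []        (x ∷ xs₂) refl _  h∉ = ⊥-elim (h∉ (here refl))
++-cancel-at (x ∷ xs₁) []        refl h∉ _  = ⊥-elim (h∉ (here refl))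
++-cancel-at (x ∷ xs₁) (y ∷ xs₂) eq   h∉₁ h∉₂ with refl , eq′ ← ∷-injective eq
  with xs≡ , ys≡ ← ++-cancel-at xs₁ xs₂ eq′ (h∉₁ ∘ there) (h∉₂ ∘ there) = cong (x ∷_) xs≡ , ys≡

AllPairs-map-on : ∀ {a q r s} {A : Set a} {Q : A → Set q} {R : A → A → Set r} {S : A → A → Set s} →
                  (∀ {x y} → Q x → Q y → R x y → S x y) → ∀ {xs} → All Q xs → AllPairs R xs → AllPairs S xs
AllPairs-map-on f []         []           = []
AllPairs-map-on {Q = Q} {R} {S} f {x ∷ _} (qx ∷ qxs) (rx ∷ rxs) = go qxs rx ∷ AllPairs-map-on f qxs rxs
  where
  go : ∀ {ys} → All Q ys → All (R x) ys → All (S x) ys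
  go []         []         = []
  go (qy ∷ qys) (r ∷ rs)   = f qx qy r ∷ go qys rs

Unique-map⁺-on : ∀ {A B : Set} {Q : A → Set} (f : A → B) → (∀ {x y} → Q x → Q y → f x ≡ f y → x ≡ y) →
                 ∀ {xs} → All Q xs → Unique xs → Unique (map f xs)
Unique-map⁺-on f inj Qxs = AllPairs.map⁺ ∘ AllPairs-map-on (λ qx qy x≢y fx≡fy → x≢y (inj qx qy fx≡fy)) Qxs

Unique-resp-↭ : ∀ {A : Set} {xs ys : List A} → xs ↭ ys → Unique xs → Unique ys
Unique-resp-↭ {A} xs↭ys = PermSetoid.Unique-resp-↭ (setoid A) (↭⇒↭ₛ xs↭ys)

module _ {A : Set} {P : A → Set} (P? : Decidable P) where

  find-sound : ∀ xs {x} → find P? xs ≡ just x → x ∈ xs × P x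
  find-sound (y ∷ ys) eq with P? y
  find-sound (y ∷ ys) refl | yes py = here refl , py
  ... | no _ = let x∈ , px = find-sound ys eq in there x∈ , px

  find-complete : ∀ {xs} → Any P xs → ∃[ x ] find P? xs ≡ just x
  find-complete {y ∷ _} pxs with P? y
  ... | yes _ = y , refl
  find-complete (here py)   | no ¬py = ⊥-elim (¬py py)
  find-complete (there pys) | no _   = find-complete pys

find-cong : ∀ {A : Set} {P Q : A → Set} (P? : Decidable P) (Q? : Decidable Q) xs →
            (∀ {x} → x ∈ xs → P x → Q x) → (∀ {x} → x ∈ xs → Q x → P x) → find P? xs ≡ find Q? xs
find-cong P? Q? []       P⇒Q Q⇒P = refl
find-cong P? Q? (x ∷ xs) P⇒Q Q⇒P with P? x | Q? x
... | yes _  | yes _  = refl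
... | yes px | no ¬qx = ⊥-elim (¬qx (P⇒Q (here refl) px))
... | no ¬px | yes qx = ⊥-elim (¬px (Q⇒P (here refl) qx))
... | no _   | no _   = find-cong P? Q? xs (P⇒Q ∘ there) (Q⇒P ∘ there)

module _ {a ℓ} (S : Setoid a ℓ) where
  open Setoid S using (_≈_) renaming (Carrier to A; sym to ≈-sym; trans to ≈-trans)

  private
    remove : ∀ {x} ys → Any (x ≈_) ys → List A
    remove (_ ∷ ys) (here _)  = ys
    remove (y ∷ ys) (there p) = y ∷ remove ys p

    length-remove : ∀ {x} ys (p : Any (x ≈_) ys) → suc (length (remove ys p)) ≡ length ys
    length-remove (_ ∷ ys) (here _)  = refl
    length-remove (y ∷ ys) (there p) = cong suc (length-remove ys p)

    remove-keeps : ∀ {x z} ys (p : Any (x ≈_) ys) → Any (z ≈_) ys → ¬ x ≈ z → Any (z ≈_) (remove ys p)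
    remove-keeps (_ ∷ ys) (here x≈y)  (here z≈y) x≉z = ⊥-elim (x≉z (≈-trans x≈y (≈-sym z≈y)))
    remove-keeps (_ ∷ ys) (here _)    (there q)  x≉z = q
    remove-keeps (_ ∷ ys) (there p)   (here z≈y) x≉z = here z≈y
    remove-keeps (_ ∷ ys) (there p)   (there q)  x≉z = there (remove-keeps ys p q x≉z)

  pairwise-distinct-covered⇒length≤ : ∀ xs ys → AllPairs (λ x y → ¬ x ≈ y) xs → All (λ x → Any (x ≈_) ys) xs →
                                      length xs ≤ length ys
  pairwise-distinct-covered⇒length≤ []       ys _              _              = z≤n
  pairwise-distinct-covered⇒length≤ (x ∷ xs) ys (x≉xs ∷ apart) (x∈ys ∷ xs∈ys) =
    ≤-trans (s≤s (pairwise-distinct-covered⇒length≤ xs (remove ys x∈ys) apart (keep x≉xs xs∈ys)))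
            (≤-reflexive (length-remove ys x∈ys))
    where
    keep : ∀ {zs} → All (λ z → ¬ x ≈ z) zs → All (λ z → Any (z ≈_) ys) zs → All (λ z → Any (z ≈_) (remove ys x∈ys)) zs
    keep []           []             = []
    keep (x≉z ∷ x≉zs) (z∈ys ∷ zs∈ys) = remove-keeps ys x∈ys z∈ys x≉z ∷ keep x≉zs zs∈ys

Unique⊆⇒length≤ : ∀ {A : Set} {xs ys : List A} → Unique xs → All (_∈ ys) xs → length xs ≤ length ys
Unique⊆⇒length≤ {A} = pairwise-distinct-covered⇒length≤ (setoid A) _ _

words : ∀ {A : Set} → ℕ → List A → List (List A)
words zero    V = [ [] ]
words (suc k) V = cartesianProductWith _∷_ V (words k V)

length-cartesianProductWith : ∀ {A B C : Set} (f : A → B → C) xs ys →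
                              length (cartesianProductWith f xs ys) ≡ length xs * length ys
length-cartesianProductWith f []       ys = refl
length-cartesianProductWith f (x ∷ xs) ys =
  trans (length-++ (map (f x) ys)) (cong₂ _+_ (length-map (f x) ys) (length-cartesianProductWith f xs ys))

length-words : ∀ {A : Set} k (V : List A) → length (words k V) ≡ length V ^ k
length-words zero    V = refl
length-words (suc k) V = trans (length-cartesianProductWith _∷_ V (words k V)) (cong (length V *_) (length-words k V))

words-complete : ∀ {A : Set} k (V : List A) w → length w ≡ k → All (_∈ V) w → w ∈ words k V
words-complete zero    V []      refl []          = here refl
words-complete (suc k) V (x ∷ w) len  (x∈V ∷ w⊆V) =
  Any.cartesianProductWith⁺ _∷_ (cong₂ _∷_) x∈V (words-complete k V w (cong pred len) w⊆V)

words-sound : ∀ {A : Set} k (V : List A) → All (λ w → length w ≡ k × All (_∈ V) w) (words k V)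
words-sound zero    V = (refl , []) ∷ []
words-sound {A} (suc k) V = All.cartesianProductWith⁺ (setoid A) (setoid (List A)) _∷_ V (words k V)
  (λ {x} {w} x∈V w∈ → let len , w⊆V = All.lookup (words-sound k V) w∈ in cong suc len , x∈V ∷ w⊆V)

size : Term → ℕ
size (var i) = 0
size (s · t) = suc (size s + size t)

length-vars : ∀ t → length (vars t) ≡ suc (size t)
length-vars (var i) = refl
length-vars (s · t) = begin
  length (vars s ++ vars t)           ≡⟨ length-++ (vars s) ⟩
  length (vars s) + length (vars t)   ≡⟨ cong₂ _+_ (length-vars s) (length-vars t) ⟩
  suc (size s) + suc (size t)         ≡⟨ cong suc (+-suc (size s) (size t)) ⟩
  suc (size (s · t))                  ∎
  where open ≡-Reasoning

root : Term → ℕ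
root (var i) = i
root (s · t) = root s

Linear-·ˡ : ∀ s t → Linear (s · t) → Linear s
Linear-·ˡ s t = Unique-++⁻ˡ (vars s)

Linear-·ʳ : ∀ s t → Linear (s · t) → Linear t
Linear-·ʳ s t = Unique-++⁻ʳ (vars s)

Linear-·-disjoint : ∀ s t {v} → Linear (s · t) → v ∈ vars s → v ∈ vars t → ⊥
Linear-·-disjoint s t = Unique-++⇒disjoint (vars s)

vars-root∷ : ∀ t → ∃[ xs ] vars t ≡ root t ∷ xs
vars-root∷ (var i) = [] , refl
vars-root∷ (s · t) with xs , eq ← vars-root∷ s rewrite eq = xs ++ vars t , refl

-- Evaluating trees

module TreeEvaluation {c ℓ : Level} (G : Magma c ℓ) (right-perm : RightPermutable G) where
  open Magma G using (Carrier; _≈_; _∙_; ∙-cong) renaming (refl to ≈-refl; sym to ≈-sym; trans to ≈-trans)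

  module _ (ρ : ℕ → Carrier) where
    mutual
      evalTree : Tree → Carrier
      evalTree (node i ts) = evalForest (ρ i) ts

      evalForest : Carrier → List Tree → Carrier
      evalForest a []       = a
      evalForest a (t ∷ ts) = evalForest (a ∙ evalTree t) ts

    evalForest-∷ʳ : ∀ a ts t → evalForest a (ts ++ [ t ]) ≡ evalForest a ts ∙ evalTree t
    evalForest-∷ʳ a []       t = refl
    evalForest-∷ʳ a (u ∷ ts) t = evalForest-∷ʳ (a ∙ evalTree u) ts t

    ⟦⟧≈evalTree∘P : ∀ s → ⟦_⟧ G s ρ ≈ evalTree (P s)
    ⟦⟧≈evalTree∘P (var i) = ≈-refl
    ⟦⟧≈evalTree∘P (s · t) with P s | ⟦⟧≈evalTree∘P s
    ... | node i ts | s≈ rewrite evalForest-∷ʳ (ρ i) ts (P t) = ∙-cong s≈ (⟦⟧≈evalTree∘P t)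

    mutual
      evalTree-resp-≅ᵘ : ∀ {T U} → T ≅ᵘ U → evalTree T ≈ evalTree U
      evalTree-resp-≅ᵘ (node ts↭us) = evalForest-resp ≈-refl ts↭us

      evalForest-resp : ∀ {a b ts us} → a ≈ b → Permutation _≅ᵘ_ ts us → evalForest a ts ≈ evalForest b us
      evalForest-resp a≈b (Perm.refl ts≅us)   = evalForest-resp-pointwise a≈b ts≅us
      evalForest-resp a≈b (Perm.prep t≅u p)   = evalForest-resp (∙-cong a≈b (evalTree-resp-≅ᵘ t≅u)) p
      evalForest-resp a≈b (Perm.swap t≅u u≅t p) =
        evalForest-resp (≈-trans (right-perm _ _ _) (∙-cong (∙-cong a≈b (evalTree-resp-≅ᵘ u≅t)) (evalTree-resp-≅ᵘ t≅u))) p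
      evalForest-resp a≈b (Perm.trans p q) = ≈-trans (evalForest-resp a≈b p) (evalForest-resp ≈-refl q)

      evalForest-resp-pointwise : ∀ {a b ts us} → a ≈ b → Pointwise _≅ᵘ_ ts us → evalForest a ts ≈ evalForest b us
      evalForest-resp-pointwise a≈b []           = a≈b
      evalForest-resp-pointwise a≈b (t≅u ∷ ts≅us) = evalForest-resp-pointwise (∙-cong a≈b (evalTree-resp-≅ᵘ t≅u)) ts≅us

  ≅ᵘ⇒≈ᵒᵖ : ∀ s t → P s ≅ᵘ P t → _≈ᵒᵖ_ G s t
  ≅ᵘ⇒≈ᵒᵖ s t Ps≅Pt ρ = ≈-trans (⟦⟧≈evalTree∘P ρ s) (≈-trans (evalTree-resp-≅ᵘ ρ Ps≅Pt) (≈-sym (⟦⟧≈evalTree∘P ρ t)))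

-- Binomial coefficients and ballot numbers

C-sym : ∀ a b → (a + b) C a ≡ (a + b) C b
C-sym a b = trans (nCk≡nC[n∸k] (m≤m+n a b)) (cong ((a + b) C_) (m+n∸m≡n a b))

C-absorb : ∀ n k → suc k * (suc n C suc k) ≡ suc n * (n C k)
C-absorb zero    zero    = refl
C-absorb zero    (suc k) = *-zeroʳ (suc (suc k))
C-absorb (suc n) zero    = trans (*-identityˡ _) (trans (nC1≡n (suc (suc n))) (sym (*-identityʳ _)))
C-absorb (suc n) (suc k) = begin
  suc (suc k) * (suc (suc n) C suc (suc k))
    ≡⟨ cong (suc (suc k) *_) (sym (nCk+nC[k+1]≡[n+1]C[k+1] (suc n) (suc k))) ⟩
  suc (suc k) * (suc n C suc k + suc n C suc (suc k))
    ≡⟨ *-distribˡ-+ (suc (suc k)) (suc n C suc k) (suc n C suc (suc k)) ⟩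
  suc (suc k) * (suc n C suc k) + suc (suc k) * (suc n C suc (suc k))
    ≡⟨ cong₂ _+_ (cong (suc n C suc k +_) (C-absorb n k)) (C-absorb n (suc k)) ⟩
  (suc n C suc k + suc n * (n C k)) + suc n * (n C suc k)
    ≡⟨ regroup (suc n C suc k) n (n C k) (n C suc k) ⟩
  suc n C suc k + suc n * (n C k + n C suc k)
    ≡⟨ cong (λ x → suc n C suc k + suc n * x) (nCk+nC[k+1]≡[n+1]C[k+1] n k) ⟩
  suc (suc n) * (suc n C suc k) ∎
  where
  open ≡-Reasoning
  regroup : ∀ b n x y → (b + suc n * x) + suc n * y ≡ b + suc n * (x + y)
  regroup = solve-∀

ballot : ℕ → ℕ → ℕ
ballot zero    zero    = 1
ballot (suc i) zero    = 0
ballot zero    (suc j) = ballot zero j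
ballot (suc i) (suc j) = ballot (suc i) j + ballot i (suc (suc j))

ballot-zero : ∀ j → ballot zero j ≡ 1
ballot-zero zero    = refl
ballot-zero (suc j) = ballot-zero j

ballot-closed : ∀ i j → ballot (suc i) j + suc (i + i + j) C i ≡ suc (i + i + j) C suc i
ballot-closed i zero = begin
  suc (i + i + 0) C i     ≡⟨ cong (_C i) (index i) ⟩
  (i + suc i) C i         ≡⟨ C-sym i (suc i) ⟩
  (i + suc i) C suc i     ≡⟨ cong (_C suc i) (index i) ⟨
  suc (i + i + 0) C suc i ∎
  where
  open ≡-Reasoning
  index : ∀ i → suc (i + i + 0) ≡ i + suc i
  index = solve-∀
ballot-closed zero (suc j) = begin
  (ballot 1 j + ballot 0 (suc (suc j))) + 1 ≡⟨ cong (λ x → ballot 1 j + x + 1) (ballot-zero (suc (suc j))) ⟩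
  (ballot 1 j + 1) + 1                      ≡⟨ +-comm (ballot 1 j + 1) 1 ⟩
  suc (ballot 1 j + 1)                      ≡⟨ cong suc (ballot-closed zero j) ⟩
  suc (suc j C 1)                           ≡⟨ cong suc (nC1≡n (suc j)) ⟩
  suc (suc j)                               ≡⟨ nC1≡n (suc (suc j)) ⟨
  suc (suc j) C 1                           ∎
  where open ≡-Reasoning
ballot-closed (suc i) (suc j) = begin
  ballot (suc (suc i)) (suc j) + suc M C suc i
    ≡⟨ cong (ballot (suc (suc i)) (suc j) +_) (nCk+nC[k+1]≡[n+1]C[k+1] M i) ⟨
  (ballot (suc (suc i)) j + ballot (suc i) (suc (suc j))) + (M C i + M C suc i)
    ≡⟨ interchange (ballot (suc (suc i)) j) (ballot (suc i) (suc (suc j))) (M C i) (M C suc i) ⟩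
  (ballot (suc (suc i)) j + M C suc i) + (ballot (suc i) (suc (suc j)) + M C i)
    ≡⟨ cong₂ _+_ (subst (λ n → ballot (suc (suc i)) j + n C suc i ≡ n C suc (suc i)) (sym (index₁ i j)) (ballot-closed (suc i) j))
                 (subst (λ n → ballot (suc i) (suc (suc j)) + n C i ≡ n C suc i) (sym (index₂ i j)) (ballot-closed i (suc (suc j)))) ⟩
  M C suc (suc i) + M C suc i
    ≡⟨ +-comm (M C suc (suc i)) (M C suc i) ⟩
  M C suc i + M C suc (suc i)
    ≡⟨ nCk+nC[k+1]≡[n+1]C[k+1] M (suc i) ⟩
  suc M C suc (suc i) ∎
  where
  open ≡-Reasoning
  M = suc (i + suc i + suc j)
  interchange : ∀ a b c d → (a + b) + (c + d) ≡ (a + d) + (b + c)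
  interchange = solve-∀
  index₁ : ∀ i j → suc (i + suc i + suc j) ≡ suc (suc i + suc i + j)
  index₁ = solve-∀
  index₂ : ∀ i j → suc (i + suc i + suc j) ≡ suc (i + i + suc (suc j))
  index₂ = solve-∀

-- (2+i) · ballot (1+i) 1 = C(2i+2, i+1) follows from ballot-closed and the absorption identity
-- (1+i) · C(2i+2, i+1) = (2+i) · C(2i+2, i).
Catalan≡ballot : ∀ m → Catalan m ≡ ballot m 1
Catalan≡ballot zero    = refl
Catalan≡ballot (suc i) = begin
  ((suc i + suc i) C suc i) / suc (suc i) ≡⟨ cong (_/ suc (suc i)) (sym G*[2+i]≡B) ⟩
  G * suc (suc i) / suc (suc i)         ≡⟨ m*n/n≡m G (suc (suc i)) ⟩
  G                                     ∎
  where
  open ≡-Reasoning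
  N = i + suc i
  G = ballot (suc i) 1
  A = suc N C i
  B = suc N C suc i
  G+A≡B : G + A ≡ B
  G+A≡B = subst (λ n → G + n C i ≡ n C suc i) (index i) (ballot-closed i 1)
    where
    index : ∀ i → suc (i + i + 1) ≡ suc (i + suc i)
    index = solve-∀
  [1+i]B≡[2+i]A : suc i * B ≡ suc (suc i) * A
  [1+i]B≡[2+i]A = begin
    suc i * B                         ≡⟨ C-absorb N i ⟩
    suc N * (N C i)                   ≡⟨ cong (suc N *_) (C-sym i (suc i)) ⟩
    suc N * (N C suc i)               ≡⟨ C-absorb N (suc i) ⟨
    suc (suc i) * (suc N C suc (suc i)) ≡⟨ cong (λ n → suc (suc i) * (n C suc (suc i))) (index i) ⟨
    suc (suc i) * ((i + suc (suc i)) C suc (suc i)) ≡⟨ cong (suc (suc i) *_) (C-sym i (suc (suc i))) ⟨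
    suc (suc i) * ((i + suc (suc i)) C i) ≡⟨ cong (λ n → suc (suc i) * (n C i)) (index i) ⟩
    suc (suc i) * A                   ∎
    where
    index : ∀ i → i + suc (suc i) ≡ suc (i + suc i)
    index = solve-∀
  G*[2+i]≡B : G * suc (suc i) ≡ B
  G*[2+i]≡B = +-cancelʳ-≡ (suc (suc i) * A) (G * suc (suc i)) B (begin
    G * suc (suc i) + suc (suc i) * A ≡⟨ factor i G A ⟩
    suc (suc i) * (G + A)             ≡⟨ cong (suc (suc i) *_) G+A≡B ⟩
    suc (suc i) * B                   ≡⟨ cong (B +_) [1+i]B≡[2+i]A ⟩
    B + suc (suc i) * A               ∎)
    where
    factor : ∀ i g a → g * suc (suc i) + suc (suc i) * a ≡ suc (suc i) * (g + a)
    factor = solve-∀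

-- Enumerating bracketings

range : ℕ → ℕ → List ℕ
range a zero    = []
range a (suc n) = a ∷ range (suc a) n

reduce : List Term → List Term
reduce (s ∷ t ∷ ts) = s · t ∷ ts
reduce ts           = ts

-- Shift-reduce parse stacks: j terms containing i applications, with variables a, a+1, …, a+i+j-1.
stacks : ℕ → ℕ → ℕ → List (List Term)
stacks a zero    zero    = [ [] ]
stacks a (suc i) zero    = []
stacks a zero    (suc j) = map (var a ∷_) (stacks (suc a) zero j)
stacks a (suc i) (suc j) = map (var a ∷_) (stacks (suc a) (suc i) j) ++ map reduce (stacks a i (suc (suc j)))

length-stacks : ∀ a i j → length (stacks a i j) ≡ ballot i j
length-stacks a zero    zero    = refl
length-stacks a (suc i) zero    = refl
length-stacks a zero    (suc j) = trans (length-map _ (stacks (suc a) zero j)) (length-stacks (suc a) zero j)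
length-stacks a (suc i) (suc j) = begin
  length (map (var a ∷_) (stacks (suc a) (suc i) j) ++ map reduce (stacks a i (suc (suc j))))
    ≡⟨ length-++ (map (var a ∷_) (stacks (suc a) (suc i) j)) ⟩
  length (map (var a ∷_) (stacks (suc a) (suc i) j)) + length (map reduce (stacks a i (suc (suc j))))
    ≡⟨ cong₂ _+_ (length-map _ (stacks (suc a) (suc i) j)) (length-map _ (stacks a i (suc (suc j)))) ⟩
  length (stacks (suc a) (suc i) j) + length (stacks a i (suc (suc j)))
    ≡⟨ cong₂ _+_ (length-stacks (suc a) (suc i) j) (length-stacks a i (suc (suc j))) ⟩
  ballot (suc i) j + ballot i (suc (suc j)) ∎
  where open ≡-Reasoning

IsStack : ℕ → ℕ → ℕ → List Term → Set
IsStack a i j ts = length ts ≡ j × concatMap vars ts ≡ range a (i + j)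

IsStack-shift : ∀ {a i j ts} → IsStack (suc a) i j ts → IsStack a i (suc j) (var a ∷ ts)
IsStack-shift {a} {i} {j} (len , vs) = cong suc len , trans (cong (a ∷_) vs) (cong (range a) (sym (+-suc i j)))

IsStack-reduce : ∀ {a i j ts} → IsStack a i (suc (suc j)) ts → IsStack a (suc i) (suc j) (reduce ts)
IsStack-reduce {a} {i} {j} {s ∷ t ∷ ts} (len , vs) =
  suc-injective len , trans (++-assoc (vars s) (vars t) (concatMap vars ts)) (trans vs (cong (range a) (+-suc i (suc j))))

stacks-sound : ∀ a i j → All (IsStack a i j) (stacks a i j)
stacks-sound a zero    zero    = (refl , refl) ∷ []
stacks-sound a (suc i) zero    = []
stacks-sound a zero    (suc j) = All.map⁺ (All.map (λ {ts} → IsStack-shift {ts = ts}) (stacks-sound (suc a) zero j))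
stacks-sound a (suc i) (suc j) = All.++⁺
  (All.map⁺ (All.map (λ {ts} → IsStack-shift {ts = ts}) (stacks-sound (suc a) (suc i) j)))
  (All.map⁺ (All.map (λ {ts} → IsStack-reduce {ts = ts}) (stacks-sound a i (suc (suc j)))))

stacks-complete : ∀ a i j ts → IsStack a i j ts → sum (map size ts) ≡ i → ts ∈ stacks a i j
stacks-complete a zero    zero    []       _          _  = here refl
stacks-complete a (suc i) zero    []       _          ()
stacks-complete a zero    (suc j) (var k ∷ ts) (len , vs) sz =
  subst (λ k → var k ∷ ts ∈ stacks a zero (suc j)) (sym (∷-injectiveˡ vs))
    (∈-map⁺ (var a ∷_) (stacks-complete (suc a) zero j ts (suc-injective len , ∷-injectiveʳ vs) sz))
stacks-complete a (suc i) (suc j) (var k ∷ ts) (len , vs) sz =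
  subst (λ k → var k ∷ ts ∈ stacks a (suc i) (suc j)) (sym (∷-injectiveˡ vs′))
    (∈-++⁺ˡ (∈-map⁺ (var a ∷_) (stacks-complete (suc a) (suc i) j ts (suc-injective len , ∷-injectiveʳ vs′) sz)))
  where vs′ = trans vs (cong (range a) (+-suc (suc i) j))
stacks-complete a (suc i) (suc j) (s · t ∷ ts) (len , vs) sz =
  ∈-++⁺ʳ (map (var a ∷_) (stacks (suc a) (suc i) j))
    (∈-map⁺ reduce (stacks-complete a i (suc (suc j)) (s ∷ t ∷ ts)
      (cong suc len , trans (sym (++-assoc (vars s) (vars t) (concatMap vars ts))) (trans vs (cong (range a) (sym (+-suc i (suc j))))))
      (trans (sym (+-assoc (size s) (size t) _)) (suc-injective sz))))

stacks-unique : ∀ a i j → Unique (stacks a i j)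
stacks-unique a zero    zero    = [] ∷ []
stacks-unique a (suc i) zero    = []
stacks-unique a zero    (suc j) = Unique.map⁺ ∷-injectiveʳ (stacks-unique (suc a) zero j)
stacks-unique a (suc i) (suc j) = Unique.++⁺
  (Unique.map⁺ ∷-injectiveʳ (stacks-unique (suc a) (suc i) j))
  (Unique-map⁺-on reduce reduce-injective (stacks-sound a i (suc (suc j))) (stacks-unique a i (suc (suc j))))
  shifted-disjoint-reduced
  where
  reduce-injective : ∀ {ss ts} → IsStack a i (suc (suc j)) ss → IsStack a i (suc (suc j)) ts → reduce ss ≡ reduce ts → ss ≡ ts
  reduce-injective {_ ∷ _ ∷ _} {_ ∷ _ ∷ _} _ _ refl = refl
  shifted-disjoint-reduced : Disjoint (map (var a ∷_) (stacks (suc a) (suc i) j)) (map reduce (stacks a i (suc (suc j))))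
  shifted-disjoint-reduced (v∈shifted , v∈reduced)
    with _ , _ , refl ← ∈-map⁻ (var a ∷_) v∈shifted
    with ts , ts∈ , eq ← ∈-map⁻ reduce v∈reduced
    with _ ∷ _ ∷ _ ← ts | len , _ ← All.lookup (stacks-sound a i (suc (suc j))) ts∈
    with () ← eq

applyUpTo-range : ∀ {f : ℕ → ℕ} a n → (∀ x → f x ≡ a + x) → applyUpTo f n ≡ range a n
applyUpTo-range a zero    f≗a+ = refl
applyUpTo-range a (suc n) f≗a+ =
  cong₂ _∷_ (trans (f≗a+ 0) (+-identityʳ a)) (applyUpTo-range (suc a) n (λ x → trans (f≗a+ (suc x)) (+-suc a x)))

upTo≡range : ∀ n → upTo n ≡ range 0 n
upTo≡range n = applyUpTo-range 0 n (λ _ → refl)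

-- The junk value var 0 never occurs below: the stacks of height 1 are singletons.
sole : List Term → Term
sole (t ∷ _) = t
sole []      = var 0

bracketings : ℕ → List Term
bracketings m = map sole (stacks 0 m 1)

length-bracketings : ∀ m → length (bracketings m) ≡ Catalan m
length-bracketings m = trans (length-map sole (stacks 0 m 1)) (trans (length-stacks 0 m 1) (sym (Catalan≡ballot m)))

IsStack⇒Bracketing : ∀ {m ts} → IsStack 0 m 1 ts → Bracketing (suc m) (sole ts)
IsStack⇒Bracketing {m} {b ∷ []} (_ , vs) = begin
  vars b          ≡⟨ ++-identityʳ (vars b) ⟨
  vars b ++ []    ≡⟨ vs ⟩
  range 0 (m + 1) ≡⟨ cong (range 0) (+-comm m 1) ⟩
  range 0 (suc m) ≡⟨ upTo≡range (suc m) ⟨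
  upTo (suc m)    ∎
  where open ≡-Reasoning

bracketings-sound : ∀ m → All (Bracketing (suc m)) (bracketings m)
bracketings-sound m = All.map⁺ (All.map (λ {ts} → IsStack⇒Bracketing {ts = ts}) (stacks-sound 0 m 1))

bracketings-complete : ∀ m b → Bracketing (suc m) b → b ∈ bracketings m
bracketings-complete m b vs≡ = ∈-map⁺ sole (stacks-complete 0 m 1 [ b ] (refl , vs) sz)
  where
  vs : vars b ++ [] ≡ range 0 (m + 1)
  vs = trans (++-identityʳ (vars b)) (trans vs≡ (trans (upTo≡range (suc m)) (cong (range 0) (+-comm 1 m))))
  sz : size b + 0 ≡ m
  sz = trans (+-identityʳ (size b))
             (suc-injective (trans (sym (length-vars b)) (trans (cong length vs≡) (length-upTo (suc m)))))

bracketings-unique : ∀ m → Unique (bracketings m)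
bracketings-unique m = Unique-map⁺-on sole sole-injective (stacks-sound 0 m 1) (stacks-unique 0 m 1)
  where
  sole-injective : ∀ {ss ts} → IsStack 0 m 1 ss → IsStack 0 m 1 ts → sole ss ≡ sole ts → ss ≡ ts
  sole-injective {_ ∷ []} {_ ∷ []} _ _ refl = refl

-- (child , parent) pairs: in s · t the root of t is the last child of the root of s.
edges : Term → List (ℕ × ℕ)
edges (var i) = []
edges (s · t) = (root t , root s) ∷ edges s ++ edges t

_⊆ᴱ_ : Term → Term → Set
s ⊆ᴱ t = ∀ {e} → e ∈ edges s → e ∈ edges t

HasParent : Term → ℕ → Set
HasParent t v = ∃[ p ] (v , p) ∈ edges t

HasChild : Term → ℕ → Set
HasChild t v = ∃[ c ] (c , v) ∈ edges t

IsLeaf : Term → ℕ → Set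
IsLeaf t v = HasParent t v × ¬ HasChild t v

isLeaf? : ∀ t v → Dec (IsLeaf t v)
isLeaf? t v = hasParent? ×-dec ¬? hasChild?
  where
  hasParent? : Dec (HasParent t v)
  hasParent? = map′ found (λ (_ , e∈) → lose e∈ refl) (any? (λ e → proj₁ e ≟ v) (edges t))
    where
    found : Any (λ e → proj₁ e ≡ v) (edges t) → HasParent t v
    found a with (_ , p) , e∈ , refl ← ∈-find a = p , e∈
  hasChild? : Dec (HasChild t v)
  hasChild? = map′ found (λ (_ , e∈) → lose e∈ refl) (any? (λ e → proj₂ e ≟ v) (edges t))
    where
    found : Any (λ e → proj₂ e ≡ v) (edges t) → HasChild t v
    found a with (c , _) , e∈ , refl ← ∈-find a = c , e∈

root∈vars : ∀ t → root t ∈ vars t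
root∈vars (var i) = here refl
root∈vars (s · t) = ∈-++⁺ˡ (root∈vars s)

child∈vars : ∀ t {c p} → (c , p) ∈ edges t → c ∈ vars t
child∈vars (s · t) (here refl) = ∈-++⁺ʳ (vars s) (root∈vars t)
child∈vars (s · t) (there e∈) with ∈-++⁻ (edges s) e∈
... | inj₁ e∈s = ∈-++⁺ˡ (child∈vars s e∈s)
... | inj₂ e∈t = ∈-++⁺ʳ (vars s) (child∈vars t e∈t)

parent∈vars : ∀ t {c p} → (c , p) ∈ edges t → p ∈ vars t
parent∈vars (s · t) (here refl) = ∈-++⁺ˡ (root∈vars s)
parent∈vars (s · t) (there e∈) with ∈-++⁻ (edges s) e∈
... | inj₁ e∈s = ∈-++⁺ˡ (parent∈vars s e∈s)
... | inj₂ e∈t = ∈-++⁺ʳ (vars s) (parent∈vars t e∈t)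

root-has-no-parent : ∀ t → Linear t → ∀ {p} → (root t , p) ∉ edges t
root-has-no-parent (s · t) lin (here e) = Linear-·-disjoint s t lin (root∈vars s) (subst (_∈ vars t) (sym (cong proj₁ e)) (root∈vars t))
root-has-no-parent (s · t) lin (there e∈) with ∈-++⁻ (edges s) e∈
... | inj₁ e∈s = root-has-no-parent s (Linear-·ˡ s t lin) e∈s
... | inj₂ e∈t = Linear-·-disjoint s t lin (root∈vars s) (child∈vars t e∈t)

parent-unique : ∀ t → Linear t → ∀ {c p q} → (c , p) ∈ edges t → (c , q) ∈ edges t → p ≡ q
parent-unique (s · t) lin (here refl) (here refl) = refl
parent-unique (s · t) lin (here refl) (there e∈) = ⊥-elim (root-not-below s t lin e∈)
  where
  root-not-below : ∀ s t → Linear (s · t) → ∀ {q} → (root t , q) ∈ edges s ++ edges t → ⊥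
  root-not-below s t lin e∈ with ∈-++⁻ (edges s) e∈
  ... | inj₁ e∈s = Linear-·-disjoint s t lin (child∈vars s e∈s) (root∈vars t)
  ... | inj₂ e∈t = root-has-no-parent t (Linear-·ʳ s t lin) e∈t
parent-unique (s · t) lin e∈@(there _) (here refl) = sym (parent-unique (s · t) lin (here refl) e∈)
parent-unique (s · t) lin (there e₁∈) (there e₂∈) with ∈-++⁻ (edges s) e₁∈ | ∈-++⁻ (edges s) e₂∈
... | inj₁ e₁∈s | inj₁ e₂∈s = parent-unique s (Linear-·ˡ s t lin) e₁∈s e₂∈s
... | inj₁ e₁∈s | inj₂ e₂∈t = ⊥-elim (Linear-·-disjoint s t lin (child∈vars s e₁∈s) (child∈vars t e₂∈t))
... | inj₂ e₁∈t | inj₁ e₂∈s = ⊥-elim (Linear-·-disjoint s t lin (child∈vars s e₂∈s) (child∈vars t e₁∈t))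
... | inj₂ e₁∈t | inj₂ e₂∈t = parent-unique t (Linear-·ʳ s t lin) e₁∈t e₂∈t

non-root⇒HasParent : ∀ t → Linear t → ∀ {v} → v ∈ vars t → v ≢ root t → HasParent t v
non-root⇒HasParent (var i) lin (here refl) v≢i = ⊥-elim (v≢i refl)
non-root⇒HasParent (s · t) lin {v} v∈ v≢root with ∈-++⁻ (vars s) v∈
... | inj₁ v∈s = let p , e∈ = non-root⇒HasParent s (Linear-·ˡ s t lin) v∈s v≢root in p , there (∈-++⁺ˡ e∈)
... | inj₂ v∈t with v ≟ root t
...   | yes refl = root s , here refl
...   | no v≢rt  = let p , e∈ = non-root⇒HasParent t (Linear-·ʳ s t lin) v∈t v≢rt in p , there (∈-++⁺ʳ (edges s) e∈)

lastVar : Term → ℕ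
lastVar (var i) = i
lastVar (s · t) = lastVar t

lastVar∈vars : ∀ t → lastVar t ∈ vars t
lastVar∈vars (var i) = here refl
lastVar∈vars (s · t) = ∈-++⁺ʳ (vars s) (lastVar∈vars t)

lastVar-childless : ∀ t → Linear t → ¬ HasChild t (lastVar t)
lastVar-childless (s · t) lin (c , here e) =
  Linear-·-disjoint s t lin (subst (_∈ vars s) (sym (cong proj₂ e)) (root∈vars s)) (lastVar∈vars t)
lastVar-childless (s · t) lin (c , there e∈) with ∈-++⁻ (edges s) e∈
... | inj₁ e∈s = Linear-·-disjoint s t lin (parent∈vars s e∈s) (lastVar∈vars t)
... | inj₂ e∈t = lastVar-childless t (Linear-·ʳ s t lin) (c , e∈t)

lastVar-IsLeaf : ∀ s t → Linear (s · t) → IsLeaf (s · t) (lastVar t)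
lastVar-IsLeaf s t lin =
  non-root⇒HasParent (s · t) lin (lastVar∈vars (s · t))
    (λ e → Linear-·-disjoint s t lin (subst (_∈ vars s) (sym e) (root∈vars s)) (lastVar∈vars t)) ,
  lastVar-childless (s · t) lin

-- Removing and inserting leaves

_without_ : List ℕ → ℕ → List ℕ
xs without l = filter (λ x → ¬? (x ≟ l)) xs

without-++ : ∀ l xs ys → (xs ++ ys) without l ≡ xs without l ++ ys without l
without-++ l = filter-++ (λ x → ¬? (x ≟ l))

without-fresh : ∀ l xs → l ∉ xs → xs without l ≡ xs
without-fresh l xs l∉ = filter-all (λ x → ¬? (x ≟ l)) (All.tabulate λ { x∈ refl → l∉ x∈ })

∈-without⁺ : ∀ l {v xs} → v ∈ xs → v ≢ l → v ∈ xs without l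
∈-without⁺ l = ∈-filter⁺ (λ x → ¬? (x ≟ l))

∈-without⁻ : ∀ l {v} xs → v ∈ xs without l → v ∈ xs × v ≢ l
∈-without⁻ l xs = ∈-filter⁻ (λ x → ¬? (x ≟ l)) {xs = xs}

Unique-without : ∀ l {xs} → Unique xs → Unique (xs without l)
Unique-without l = Unique.filter⁺ (λ x → ¬? (x ≟ l))

without-↭ : ∀ l {xs ys} → xs ↭ ys → xs without l ↭ ys without l
without-↭ l = filter-↭ (λ x → ¬? (x ≟ l))

↭-without : ∀ l {xs} → l ∈ xs → Unique xs → xs ↭ l ∷ xs without l
↭-without l {x ∷ xs} (here refl) (x∉ ∷ _) =
  ↭-prep x (↭-reflexive (sym (trans (filter-reject (λ y → ¬? (y ≟ l)) (λ l≢l → l≢l refl))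
                                    (without-fresh l xs (λ l∈ → All.lookup x∉ l∈ refl)))))
↭-without l {x ∷ xs} (there l∈) (x∉ ∷ uxs) =
  ↭-trans (↭-prep x (↭-without l l∈ uxs))
    (↭-trans (↭-swap x l ↭-refl) (↭-reflexive (cong (l ∷_) (sym (filter-accept (λ y → ¬? (y ≟ l)) x≢l)))))
  where
  x≢l : x ≢ l
  x≢l refl = All.lookup x∉ l∈ refl

-- A leaf l of P_t other than its root occurs in t as a factor s · var l.
removeLeaf : ℕ → Term → Term
removeLeaf l (var i) = var i
removeLeaf l (s · var j) with j ≟ l
... | yes _ = s
... | no _  = removeLeaf l s · var j
removeLeaf l (s · (a · b)) = removeLeaf l s · removeLeaf l (a · b)

root-removeLeaf : ∀ l t → root (removeLeaf l t) ≡ root t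
root-removeLeaf l (var i) = refl
root-removeLeaf l (s · var j) with j ≟ l
... | yes _ = refl
... | no _  = root-removeLeaf l s
root-removeLeaf l (s · (a · b)) = root-removeLeaf l s

removeLeaf-fresh : ∀ l t → l ∉ vars t → removeLeaf l t ≡ t
removeLeaf-fresh l (var i) l∉ = refl
removeLeaf-fresh l (s · var j) l∉ with j ≟ l
... | yes refl = ⊥-elim (l∉ (∈-++⁺ʳ (vars s) (here refl)))
... | no _     = cong (_· var j) (removeLeaf-fresh l s (l∉ ∘ ∈-++⁺ˡ))
removeLeaf-fresh l (s · (a · b)) l∉ =
  cong₂ _·_ (removeLeaf-fresh l s (λ l∈ → l∉ (∈-++⁺ˡ l∈))) (removeLeaf-fresh l (a · b) (λ l∈ → l∉ (∈-++⁺ʳ (vars s) l∈)))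

edges-removeLeaf⊆ : ∀ l t {e} → e ∈ edges (removeLeaf l t) → e ∈ edges t
edges-removeLeaf⊆ l (s · var j) e∈ with j ≟ l
edges-removeLeaf⊆ l (s · var j) e∈          | yes _ = there (∈-++⁺ˡ e∈)
edges-removeLeaf⊆ l (s · var j) (here refl) | no _ rewrite root-removeLeaf l s = here refl
edges-removeLeaf⊆ l (s · var j) (there e∈)  | no _ with ∈-++⁻ (edges (removeLeaf l s)) e∈
... | inj₁ e∈s = there (∈-++⁺ˡ (edges-removeLeaf⊆ l s e∈s))
edges-removeLeaf⊆ l (s · (a · b)) (here refl) rewrite root-removeLeaf l s | root-removeLeaf l (a · b) = here refl
edges-removeLeaf⊆ l (s · (a · b)) (there e∈) =
  [ (λ e∈s → there (∈-++⁺ˡ (edges-removeLeaf⊆ l s e∈s))) , (λ e∈ab → there (∈-++⁺ʳ (edges s) (edges-removeLeaf⊆ l (a · b) e∈ab))) ]′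
    (∈-++⁻ (edges (removeLeaf l s)) e∈)

edges-removeLeaf⊇ : ∀ l t {c p} → (c , p) ∈ edges t → c ≢ l → (c , p) ∈ edges (removeLeaf l t)
edges-removeLeaf⊇ l (s · var j) e∈ c≢l with j ≟ l
edges-removeLeaf⊇ l (s · var j) (here refl) c≢l | yes j≡l = ⊥-elim (c≢l j≡l)
edges-removeLeaf⊇ l (s · var j) (there e∈)  c≢l | yes _ with ∈-++⁻ (edges s) e∈
... | inj₁ e∈s = e∈s
edges-removeLeaf⊇ l (s · var j) (here refl) c≢l | no _ rewrite root-removeLeaf l s = here refl
edges-removeLeaf⊇ l (s · var j) (there e∈)  c≢l | no _ with ∈-++⁻ (edges s) e∈
... | inj₁ e∈s = there (∈-++⁺ˡ (edges-removeLeaf⊇ l s e∈s c≢l))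
edges-removeLeaf⊇ l (s · (a · b)) (here refl) c≢l rewrite root-removeLeaf l s | root-removeLeaf l (a · b) = here refl
edges-removeLeaf⊇ l (s · (a · b)) (there e∈) c≢l =
  [ (λ e∈s → there (∈-++⁺ˡ (edges-removeLeaf⊇ l s e∈s c≢l)))
  , (λ e∈ab → there (∈-++⁺ʳ (edges (removeLeaf l s)) (edges-removeLeaf⊇ l (a · b) e∈ab c≢l))) ]′
    (∈-++⁻ (edges s) e∈)

vars-removeLeaf : ∀ l t → Linear t → l ≢ root t → ¬ HasChild t l → vars (removeLeaf l t) ≡ vars t without l
vars-removeLeaf l (var i) _ l≢i _ = sym (filter-accept (λ x → ¬? (x ≟ l)) (l≢i ∘ sym))
vars-removeLeaf l (s · var j) lin l≢root childless with j ≟ l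
... | yes refl = sym (begin
  (vars s ++ [ j ]) without j         ≡⟨ without-++ j (vars s) [ j ] ⟩
  vars s without j ++ [ j ] without j ≡⟨ cong₂ _++_ (without-fresh j (vars s) (λ j∈ → Linear-·-disjoint s (var j) lin j∈ (here refl)))
                                                    (filter-reject (λ x → ¬? (x ≟ j)) (λ j≢j → j≢j refl)) ⟩
  vars s ++ []                        ≡⟨ ++-identityʳ (vars s) ⟩
  vars s                              ∎)
  where open ≡-Reasoning
... | no j≢l = begin
  vars (removeLeaf l s) ++ [ j ]      ≡⟨ cong (_++ [ j ]) (vars-removeLeaf l s (Linear-·ˡ s (var j) lin) l≢root (childless ∘ below-s)) ⟩
  vars s without l ++ [ j ]           ≡⟨ cong (vars s without l ++_) (filter-accept (λ x → ¬? (x ≟ l)) j≢l) ⟨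
  vars s without l ++ [ j ] without l ≡⟨ without-++ l (vars s) [ j ] ⟨
  (vars s ++ [ j ]) without l         ∎
  where
  open ≡-Reasoning
  below-s : HasChild s l → HasChild (s · var j) l
  below-s (c , e∈) = c , there (∈-++⁺ˡ e∈)
vars-removeLeaf l (s · (a · b)) lin l≢root childless = begin
  vars (removeLeaf l s) ++ vars (removeLeaf l (a · b))
    ≡⟨ cong₂ _++_ (vars-removeLeaf l s (Linear-·ˡ s (a · b) lin) l≢root (childless ∘ below-s))
                  (vars-removeLeaf l (a · b) (Linear-·ʳ s (a · b) lin) l≢root-ab (childless ∘ below-ab)) ⟩
  vars s without l ++ vars (a · b) without l
    ≡⟨ without-++ l (vars s) (vars (a · b)) ⟨
  (vars s ++ vars (a · b)) without l ∎
  where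
  open ≡-Reasoning
  below-s : HasChild s l → HasChild (s · (a · b)) l
  below-s (c , e∈) = c , there (∈-++⁺ˡ e∈)
  below-ab : HasChild (a · b) l → HasChild (s · (a · b)) l
  below-ab (c , e∈) = c , there (∈-++⁺ʳ (edges s) e∈)
  l≢root-ab : l ≢ root a
  l≢root-ab refl = childless (root b , there (∈-++⁺ʳ (edges s) (here refl)))

insertAfter : ℕ → ℕ → List ℕ → List ℕ
insertAfter p l []       = []
insertAfter p l (x ∷ xs) with x ≟ p
... | yes _ = x ∷ l ∷ insertAfter p l xs
... | no _  = x ∷ insertAfter p l xs

insertAfter-++ : ∀ p l xs ys → insertAfter p l (xs ++ ys) ≡ insertAfter p l xs ++ insertAfter p l ys
insertAfter-++ p l []       ys = refl
insertAfter-++ p l (x ∷ xs) ys with x ≟ p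
... | yes _ = cong (λ zs → x ∷ l ∷ zs) (insertAfter-++ p l xs ys)
... | no _  = cong (x ∷_) (insertAfter-++ p l xs ys)

insertAfter-fresh : ∀ p l xs → p ∉ xs → insertAfter p l xs ≡ xs
insertAfter-fresh p l []       p∉ = refl
insertAfter-fresh p l (x ∷ xs) p∉ with x ≟ p
... | yes refl = ⊥-elim (p∉ (here refl))
... | no _     = cong (x ∷_) (insertAfter-fresh p l xs (p∉ ∘ there))

insertAfter-↭ : ∀ p l xs → p ∈ xs → Unique xs → insertAfter p l xs ↭ l ∷ xs
insertAfter-↭ p l (x ∷ xs) p∈ (x∉ ∷ u) with x ≟ p
... | yes refl = ↭-trans (↭-prep x (↭-prep l (↭-reflexive (insertAfter-fresh x l xs (λ x∈ → All.lookup x∉ x∈ refl))))) (↭-swap x l ↭-refl)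
insertAfter-↭ p l (x ∷ xs) (here refl) _       | no x≢x = ⊥-elim (x≢x refl)
insertAfter-↭ p l (x ∷ xs) (there p∈) (_ ∷ u)  | no _   = ↭-trans (↭-prep x (insertAfter-↭ p l xs p∈ u)) (↭-swap x l ↭-refl)

insertLeaf : ℕ → ℕ → Term → Term
insertLeaf p l (var i) with i ≟ p
... | yes _ = var i · var l
... | no _  = var i
insertLeaf p l (s · t) = insertLeaf p l s · insertLeaf p l t

root-insertLeaf : ∀ p l t → root (insertLeaf p l t) ≡ root t
root-insertLeaf p l (var i) with i ≟ p
... | yes _ = refl
... | no _  = refl
root-insertLeaf p l (s · t) = root-insertLeaf p l s

insertLeaf-fresh : ∀ p l t → p ∉ vars t → insertLeaf p l t ≡ t
insertLeaf-fresh p l (var i) p∉ with i ≟ p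
... | yes refl = ⊥-elim (p∉ (here refl))
... | no _     = refl
insertLeaf-fresh p l (s · t) p∉ =
  cong₂ _·_ (insertLeaf-fresh p l s (p∉ ∘ ∈-++⁺ˡ)) (insertLeaf-fresh p l t (p∉ ∘ ∈-++⁺ʳ (vars s)))

edges-insertLeaf⁻ : ∀ p l t {e} → e ∈ edges (insertLeaf p l t) → e ≡ (l , p) ⊎ e ∈ edges t
edges-insertLeaf⁻ p l (var i) e∈ with i ≟ p
edges-insertLeaf⁻ p l (var i) (here refl) | yes refl = inj₁ refl
edges-insertLeaf⁻ p l (s · t) (here refl) rewrite root-insertLeaf p l s | root-insertLeaf p l t = inj₂ (here refl)
edges-insertLeaf⁻ p l (s · t) (there e∈) with ∈-++⁻ (edges (insertLeaf p l s)) e∈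
... | inj₁ e∈s = map₂ (there ∘ ∈-++⁺ˡ) (edges-insertLeaf⁻ p l s e∈s)
... | inj₂ e∈t = map₂ (there ∘ ∈-++⁺ʳ (edges s)) (edges-insertLeaf⁻ p l t e∈t)

edges-insertLeaf⁺ : ∀ p l t {e} → e ∈ edges t → e ∈ edges (insertLeaf p l t)
edges-insertLeaf⁺ p l (s · t) (here refl) rewrite root-insertLeaf p l s | root-insertLeaf p l t = here refl
edges-insertLeaf⁺ p l (s · t) (there e∈) with ∈-++⁻ (edges s) e∈
... | inj₁ e∈s = there (∈-++⁺ˡ (edges-insertLeaf⁺ p l s e∈s))
... | inj₂ e∈t = there (∈-++⁺ʳ (edges (insertLeaf p l s)) (edges-insertLeaf⁺ p l t e∈t))

edges-insertLeaf-new : ∀ p l t → p ∈ vars t → (l , p) ∈ edges (insertLeaf p l t)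
edges-insertLeaf-new p l (var i) (here refl) with i ≟ i
... | yes _   = here refl
... | no i≢i = ⊥-elim (i≢i refl)
edges-insertLeaf-new p l (s · t) p∈ with ∈-++⁻ (vars s) p∈
... | inj₁ p∈s = there (∈-++⁺ˡ (edges-insertLeaf-new p l s p∈s))
... | inj₂ p∈t = there (∈-++⁺ʳ (edges (insertLeaf p l s)) (edges-insertLeaf-new p l t p∈t))

vars-insertLeaf : ∀ p l t → vars (insertLeaf p l t) ≡ insertAfter p l (vars t)
vars-insertLeaf p l (var i) with i ≟ p
... | yes _ = refl
... | no _  = refl
vars-insertLeaf p l (s · t) = trans (cong₂ _++_ (vars-insertLeaf p l s) (vars-insertLeaf p l t)) (sym (insertAfter-++ p l (vars s) (vars t)))

insertLeaf-removeLeaf-fresh : ∀ p l u → p ∉ vars u → l ∉ vars u → insertLeaf p l (removeLeaf l u) ≡ u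
insertLeaf-removeLeaf-fresh p l u p∉ l∉ = trans (cong (insertLeaf p l) (removeLeaf-fresh l u l∉)) (insertLeaf-fresh p l u p∉)

module LeafSemantics {c ℓ : Level} (G : Magma c ℓ) (right-perm : RightPermutable G) where
  open Magma G using (Carrier; _≈_; _∙_; ∙-cong) renaming (refl to ≈-refl; sym to ≈-sym; trans to ≈-trans; reflexive to ≈-reflexive)

  graft : ℕ → ℕ → (ℕ → Carrier) → ℕ → Carrier
  graft p l ρ i with i ≟ p
  ... | yes _ = ρ i ∙ ρ l
  ... | no _  = ρ i

  ⟦insertLeaf⟧ : ∀ p l u ρ → ⟦_⟧ G (insertLeaf p l u) ρ ≡ ⟦_⟧ G u (graft p l ρ)
  ⟦insertLeaf⟧ p l (var i) ρ with i ≟ p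
  ... | yes _ = refl
  ... | no _  = refl
  ⟦insertLeaf⟧ p l (s · t) ρ = cong₂ _∙_ (⟦insertLeaf⟧ p l s ρ) (⟦insertLeaf⟧ p l t ρ)

  insertLeaf-cong : ∀ p l {u v} → _≈ᵒᵖ_ G u v → _≈ᵒᵖ_ G (insertLeaf p l u) (insertLeaf p l v)
  insertLeaf-cong p l {u} {v} u≈v ρ =
    ≈-trans (≈-reflexive (⟦insertLeaf⟧ p l u ρ)) (≈-trans (u≈v (graft p l ρ)) (≈-sym (≈-reflexive (⟦insertLeaf⟧ p l v ρ))))

  ≡⇒≈ᵒᵖ : ∀ {u v} → u ≡ v → _≈ᵒᵖ_ G u v
  ≡⇒≈ᵒᵖ refl ρ = ≈-refl

  -- right permutability moves the last factor leftwards until it sits right after the root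
  ·var≈insertLeaf-root : ∀ s l → Linear s → l ∉ vars s → _≈ᵒᵖ_ G (s · var l) (insertLeaf (root s) l s)
  ·var≈insertLeaf-root (var i) l lin l∉ with i ≟ i
  ... | yes _  = λ ρ → ≈-refl
  ... | no i≢i = ⊥-elim (i≢i refl)
  ·var≈insertLeaf-root (a · b) l lin l∉ ρ =
    ≈-trans (right-perm (⟦_⟧ G a ρ) (⟦_⟧ G b ρ) (ρ l))
      (∙-cong (·var≈insertLeaf-root a l (Linear-·ˡ a b lin) (l∉ ∘ ∈-++⁺ˡ) ρ)
              (≡⇒≈ᵒᵖ (sym (insertLeaf-fresh (root a) l b (Linear-·-disjoint a b lin (root∈vars a)))) ρ))

  ≈insertLeaf-removeLeaf : ∀ t l p → Linear t → l ≢ root t → ¬ HasChild t l → (l , p) ∈ edges t →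
                           _≈ᵒᵖ_ G t (insertLeaf p l (removeLeaf l t))
  ≈insertLeaf-removeLeaf (s · var j) l p lin l≢root childless e∈ with j ≟ l
  ≈insertLeaf-removeLeaf (s · var j) l p lin l≢root childless (here refl) | yes refl =
    ·var≈insertLeaf-root s j (Linear-·ˡ s (var j) lin) (λ j∈ → Linear-·-disjoint s (var j) lin j∈ (here refl))
  ≈insertLeaf-removeLeaf (s · var j) l p lin l≢root childless (there e∈) | yes refl with ∈-++⁻ (edges s) e∈
  ... | inj₁ e∈s = ⊥-elim (Linear-·-disjoint s (var j) lin (child∈vars s e∈s) (here refl))
  ≈insertLeaf-removeLeaf (s · var j) l p lin l≢root childless (here refl) | no j≢j = ⊥-elim (j≢j refl)
  ≈insertLeaf-removeLeaf (s · var j) l p lin l≢root childless (there e∈) | no j≢l with ∈-++⁻ (edges s) e∈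
  ... | inj₁ e∈s = λ ρ → ∙-cong
    (≈insertLeaf-removeLeaf s l p (Linear-·ˡ s (var j) lin) l≢root (λ (c , e∈) → childless (c , there (∈-++⁺ˡ e∈))) e∈s ρ)
    (≡⇒≈ᵒᵖ (sym (insertLeaf-fresh p l (var j) p∉j)) ρ)
    where
    p∉j : p ∉ vars (var j)
    p∉j (here refl) = Linear-·-disjoint s (var j) lin (parent∈vars s e∈s) (here refl)
  ≈insertLeaf-removeLeaf (s · (a · b)) l p lin l≢root childless (here e) =
    ⊥-elim (childless (root b , there (∈-++⁺ʳ (edges s) (here (cong (root b ,_) (cong proj₁ e))))))
  ≈insertLeaf-removeLeaf (s · (a · b)) l p lin l≢root childless (there e∈) =
    [ (λ e∈s ρ → ∙-cong
        (≈insertLeaf-removeLeaf s l p (Linear-·ˡ s (a · b) lin) l≢root (λ (c , e∈) → childless (c , there (∈-++⁺ˡ e∈))) e∈s ρ)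
        (≡⇒≈ᵒᵖ (sym (insertLeaf-removeLeaf-fresh p l (a · b) (disjoint (parent∈vars s e∈s)) (disjoint (child∈vars s e∈s)))) ρ))
    , (λ e∈ab ρ → ∙-cong
        (≡⇒≈ᵒᵖ (sym (insertLeaf-removeLeaf-fresh p l s (λ p∈ → disjoint p∈ (parent∈vars (a · b) e∈ab))
                                                         (λ l∈ → disjoint l∈ (child∈vars (a · b) e∈ab)))) ρ)
        (≈insertLeaf-removeLeaf (a · b) l p (Linear-·ʳ s (a · b) lin) l≢root-a
           (λ (c , e∈) → childless (c , there (∈-++⁺ʳ (edges s) e∈))) e∈ab ρ))
    ]′ (∈-++⁻ (edges s) e∈)
    where
    disjoint : ∀ {v} → v ∈ vars s → v ∉ vars (a · b)
    disjoint = Linear-·-disjoint s (a · b) lin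
    l≢root-a : l ≢ root a
    l≢root-a l≡root = childless (root b , there (∈-++⁺ʳ (edges s) (here (cong (root b ,_) l≡root))))

-- Prüfer codes

record Spans (k : ℕ) (V : List ℕ) (t : Term) : Set where
  field
    unique  : Unique V
    vars↭   : vars t ↭ V
    length≡ : length V ≡ suc k

  linear : Linear t
  linear = Unique-resp-↭ (↭-sym vars↭) unique

Spans-zero⇒var : ∀ {V t} → Spans zero V t → t ≡ var (root t)
Spans-zero⇒var {t = var i} _ = refl
Spans-zero⇒var {t = s · u} sp
  with () ← suc-injective (trans (sym (length-vars (s · u))) (trans (↭-length (Spans.vars↭ sp)) (Spans.length≡ sp)))

parent : Term → ℕ → ℕ
parent t v with find (λ e → proj₁ e ≟ v) (edges t)
... | just (_ , p) = p
... | nothing      = 0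

parent-edge : ∀ t {v} → HasParent t v → (v , parent t v) ∈ edges t
parent-edge t {v} (p , e∈) with find (λ e → proj₁ e ≟ v) (edges t) in found
... | just (c , q) with e∈′ , refl ← find-sound (λ e → proj₁ e ≟ v) (edges t) found = e∈′
... | nothing with () ← trans (sym found) (proj₂ (find-complete (λ e → proj₁ e ≟ v) (lose e∈ refl)))

-- The nothing-branches are never taken on trees and codes of matching size.
encode : ℕ → List ℕ → Term → List ℕ
encode zero    V t = []
encode (suc k) V t with find (isLeaf? t) V
... | just l  = parent t l ∷ encode k (V without l) (removeLeaf l t)
... | nothing = []

decode : List ℕ → List ℕ → Term
decode V       (c ∷ cs) with find (λ v → ¬? (v ∈? c ∷ cs)) V
... | just l  = insertLeaf c l (decode (V without l) cs)
... | nothing = var 0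
decode (v ∷ _) []       = var v
decode []      []       = var 0

encode-step : ∀ k V t {l} → find (isLeaf? t) V ≡ just l →
              encode (suc k) V t ≡ parent t l ∷ encode k (V without l) (removeLeaf l t)
encode-step k V t found rewrite found = refl

decode-step : ∀ V c cs {l} → find (λ v → ¬? (v ∈? c ∷ cs)) V ≡ just l →
              decode V (c ∷ cs) ≡ insertLeaf c l (decode (V without l) cs)
decode-step V c cs found rewrite found = refl

record FirstLeaf (k : ℕ) (V : List ℕ) (t : Term) : Set where
  field
    leaf     : ℕ
    found    : find (isLeaf? t) V ≡ just leaf
    leaf∈V   : leaf ∈ V
    isLeaf   : IsLeaf t leaf
    edge     : (leaf , parent t leaf) ∈ edges t
    ≢root    : leaf ≢ root t
    vars-rest : vars (removeLeaf leaf t) ≡ vars t without leaf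
    rest     : Spans k (V without leaf) (removeLeaf leaf t)

  parent≢leaf : parent t leaf ≢ leaf
  parent≢leaf p≡l = proj₂ isLeaf (leaf , subst (λ p → (leaf , p) ∈ edges t) p≡l edge)

firstLeaf : ∀ {k V t} → Spans (suc k) V t → FirstLeaf k V t
firstLeaf {k} {V} {var i} sp with () ← suc-injective (trans (↭-length (Spans.vars↭ sp)) (Spans.length≡ sp))
firstLeaf {k} {V} {t@(s · u)} sp = record
  { leaf = l ; found = found ; leaf∈V = l∈V ; isLeaf = leaf-l ; edge = edge ; ≢root = l≢root
  ; vars-rest = vars-rest
  ; rest = record
    { unique  = Unique-without l unique
    ; vars↭   = subst (_↭ V without l) (sym vars-rest) (without-↭ l vars↭)
    ; length≡ = suc-injective (trans (sym (↭-length (↭-without l l∈V unique))) length≡) } }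
  where
  open Spans sp
  found-l = find-complete (isLeaf? t) (lose (∈-resp-↭ vars↭ (lastVar∈vars t)) (lastVar-IsLeaf s u linear))
  l = proj₁ found-l
  found = proj₂ found-l
  l∈V = proj₁ (find-sound (isLeaf? t) V found)
  leaf-l = proj₂ (find-sound (isLeaf? t) V found)
  edge = parent-edge t (proj₁ leaf-l)
  l≢root : l ≢ root t
  l≢root l≡root = root-has-no-parent t linear (subst (λ v → (v , parent t l) ∈ edges t) l≡root edge)
  vars-rest = vars-removeLeaf l t linear l≢root (proj₂ leaf-l)

record IsPrüferCode (k : ℕ) (V : List ℕ) (t : Term) (code : List ℕ) : Set where
  field
    ⊆V            : All (_∈ V) code
    length≡       : length code ≡ k
    ∈⇒HasChild    : ∀ {v} → v ≢ root t → v ∈ code → HasChild t v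
    HasChild⇒∈    : ∀ {v} → v ∈ V → HasChild t v → v ∈ code
    root∈         : ∀ {k′} → k ≡ suc k′ → root t ∈ code

encode-spec : ∀ {k V t} → Spans k V t → IsPrüferCode k V t (encode k V t)
encode-spec {zero} {V} {t} sp rewrite Spans-zero⇒var sp = record
  { ⊆V = [] ; length≡ = refl ; ∈⇒HasChild = λ _ () ; HasChild⇒∈ = λ _ () ; root∈ = λ () }
encode-spec {suc k} {V} {t} sp = subst (IsPrüferCode (suc k) V t) (sym (encode-step k V t found)) record
  { ⊆V         = ∈-resp-↭ vars↭ (parent∈vars t edge) ∷ All.map (proj₁ ∘ ∈-without⁻ leaf V) IH.⊆V
  ; length≡    = cong suc IH.length≡
  ; ∈⇒HasChild = ∈⇒HasChild
  ; HasChild⇒∈ = HasChild⇒∈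
  ; root∈      = λ _ → root∈ k rest IH.root∈
  }
  where
  open Spans sp
  open FirstLeaf (firstLeaf sp)
  p = parent t leaf
  t′ = removeLeaf leaf t
  code′ = encode k (V without leaf) t′
  module IH = IsPrüferCode (encode-spec rest)

  ∈⇒HasChild : ∀ {v} → v ≢ root t → v ∈ p ∷ code′ → HasChild t v
  ∈⇒HasChild _      (here refl) = leaf , edge
  ∈⇒HasChild v≢root (there v∈)  =
    let c , e∈ = IH.∈⇒HasChild (λ v≡ → v≢root (trans v≡ (root-removeLeaf leaf t))) v∈ in c , edges-removeLeaf⊆ leaf t e∈

  HasChild⇒∈ : ∀ {v} → v ∈ V → HasChild t v → v ∈ p ∷ code′
  HasChild⇒∈ v∈V (c , e∈) with c ≟ leaf
  ... | yes refl = here (parent-unique t linear e∈ edge)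
  ... | no c≢l   = there (IH.HasChild⇒∈ (∈-without⁺ leaf v∈V v≢l) (c , edges-removeLeaf⊇ leaf t e∈ c≢l))
    where
    v≢l : _ ≢ leaf
    v≢l refl = proj₂ isLeaf (c , e∈)

  root∈ : ∀ k → Spans k (V without leaf) t′ → (∀ {k′} → k ≡ suc k′ → root t′ ∈ encode k (V without leaf) t′) →
          root t ∈ p ∷ encode k (V without leaf) t′
  root∈ zero    sp′ _      = here (sym (trans p≡root′ (root-removeLeaf leaf t)))
    where
    p∈t′ : p ∈ vars t′
    p∈t′ = subst (p ∈_) (sym vars-rest) (∈-without⁺ leaf (parent∈vars t edge) parent≢leaf)
    p≡root′ : p ≡ root t′
    p≡root′ with here p≡ ← subst (λ u → p ∈ vars u) (Spans-zero⇒var sp′) p∈t′ = p≡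
  root∈ (suc k) _   root′∈ = there (subst (_∈ encode (suc k) (V without leaf) t′) (root-removeLeaf leaf t) (root′∈ refl))

fresh-exists : ∀ V code → Unique V → length code < length V → ∃[ l ] find (λ v → ¬? (v ∈? code)) V ≡ just l
fresh-exists V code unique shorter =
  find-complete (λ v → ¬? (v ∈? code)) (All.¬All⇒Any¬ (_∈? code) V (λ V⊆code → <⇒≱ shorter (Unique⊆⇒length≤ unique V⊆code)))

-- The leaves of t are exactly the vertices of V missing from its code.
decode-finds-first-leaf : ∀ {k V t} (sp : Spans (suc k) V t) →
  find (λ v → ¬? (v ∈? encode (suc k) V t)) V ≡ just (FirstLeaf.leaf (firstLeaf sp))
decode-finds-first-leaf {k} {V} {t} sp = trans (sym (find-cong (isLeaf? t) (λ v → ¬? (v ∈? code)) V leaf⇒∉ ∉⇒leaf)) found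
  where
  open Spans sp
  open FirstLeaf (firstLeaf sp)
  code = encode (suc k) V t
  module C = IsPrüferCode (encode-spec sp)
  leaf⇒∉ : ∀ {v} → v ∈ V → IsLeaf t v → v ∉ code
  leaf⇒∉ {v} _ ((p , e∈) , childless) v∈code with v ≟ root t
  ... | yes refl = root-has-no-parent t linear e∈
  ... | no v≢root = childless (C.∈⇒HasChild v≢root v∈code)
  ∉⇒leaf : ∀ {v} → v ∈ V → v ∉ code → IsLeaf t v
  ∉⇒leaf {v} v∈V v∉code with v ≟ root t
  ... | yes refl  = ⊥-elim (v∉code (C.root∈ refl))
  ... | no v≢root = non-root⇒HasParent t linear (∈-resp-↭ (↭-sym vars↭) v∈V) v≢root , v∉code ∘ C.HasChild⇒∈ v∈V

decode-encode-suc : ∀ {k V t} (sp : Spans (suc k) V t) → let open FirstLeaf (firstLeaf sp) in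
  decode V (encode (suc k) V t) ≡ insertLeaf (parent t leaf) leaf (decode (V without leaf) (encode k (V without leaf) (removeLeaf leaf t)))
decode-encode-suc {k} {V} {t} sp = trans (cong (decode V) code≡)
  (decode-step V (parent t leaf) (encode k (V without leaf) (removeLeaf leaf t))
    (subst (λ code → find (λ v → ¬? (v ∈? code)) V ≡ just leaf) code≡ (decode-finds-first-leaf sp)))
  where
  open FirstLeaf (firstLeaf sp)
  code≡ = encode-step k V t found

decode-encode-zero : ∀ {V t} → Spans zero V t → decode V [] ≡ t
decode-encode-zero {t = var i} sp with refl ← ↭-singleton-inv (↭-sym (Spans.vars↭ sp)) = refl
decode-encode-zero {t = s · u} sp with () ← Spans-zero⇒var sp

vars-decode : ∀ V code → Unique V → length V ≡ suc (length code) → All (_∈ V) code → vars (decode V code) ↭ V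
vars-decode (v ∷ []) [] _ _ _ = ↭-refl
vars-decode V (c ∷ cs) unique len≡ (c∈V ∷ cs⊆V)
  with l , found ← fresh-exists V (c ∷ cs) unique (≤-reflexive (sym len≡)) = begin
  vars (decode V (c ∷ cs))                     ≡⟨ cong vars (decode-step V c cs found) ⟩
  vars (insertLeaf c l D)                      ≡⟨ vars-insertLeaf c l D ⟩
  insertAfter c l (vars D)                     ↭⟨ insertAfter-↭ c l (vars D) (∈-resp-↭ (↭-sym IH) c∈V′) (Unique-resp-↭ (↭-sym IH) unique′) ⟩
  l ∷ vars D                                   ↭⟨ ↭-prep l IH ⟩
  l ∷ V without l                              ↭⟨ ↭-without l l∈V unique ⟨
  V                                            ∎
  where
  open PermutationReasoning
  l∈V = proj₁ (find-sound (λ v → ¬? (v ∈? c ∷ cs)) V found)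
  l∉code = proj₂ (find-sound (λ v → ¬? (v ∈? c ∷ cs)) V found)
  V′ = V without l
  unique′ = Unique-without l unique
  ∈V′ : ∀ {x} → x ∈ V → x ∈ c ∷ cs → x ∈ V′
  ∈V′ x∈V x∈code = ∈-without⁺ l x∈V (λ { refl → l∉code x∈code })
  c∈V′ = ∈V′ c∈V (here refl)
  D = decode V′ cs
  IH : vars D ↭ V′
  IH = vars-decode V′ cs unique′
         (suc-injective (trans (sym (↭-length (↭-without l l∈V unique))) len≡))
         (All.tabulate (λ {x} x∈cs → ∈V′ (All.lookup cs⊆V x∈cs) (there x∈cs)))

SameEdges : Term → Term → Set
SameEdges s t = s ⊆ᴱ t × t ⊆ᴱ s

vars-decode-encode : ∀ {k V t} → Spans k V t → vars (decode V (encode k V t)) ↭ V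
vars-decode-encode {k} {V} {t} sp = vars-decode V (encode k V t) unique (trans length≡ (cong suc (sym C.length≡))) C.⊆V
  where
  open Spans sp
  module C = IsPrüferCode (encode-spec sp)

edges-decode-encode : ∀ {k V t} → Spans k V t → SameEdges (decode V (encode k V t)) t
edges-decode-encode {zero} sp rewrite decode-encode-zero sp = (λ e∈ → e∈) , (λ e∈ → e∈)
edges-decode-encode {suc k} {V} {t} sp rewrite decode-encode-suc sp = to , from
  where
  open Spans sp
  open FirstLeaf (firstLeaf sp)
  p = parent t leaf
  D = decode (V without leaf) (encode k (V without leaf) (removeLeaf leaf t))
  IH = edges-decode-encode rest
  to : ∀ {e} → e ∈ edges (insertLeaf p leaf D) → e ∈ edges t
  to e∈ with edges-insertLeaf⁻ p leaf D e∈
  ... | inj₁ refl = edge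
  ... | inj₂ e∈D  = edges-removeLeaf⊆ leaf t (proj₁ IH e∈D)
  from : ∀ {e} → e ∈ edges t → e ∈ edges (insertLeaf p leaf D)
  from {c , q} e∈ with c ≟ leaf
  ... | yes refl = subst (λ q → (c , q) ∈ edges (insertLeaf p leaf D)) (parent-unique t linear edge e∈)
                     (edges-insertLeaf-new p leaf D (∈-resp-↭ (↭-sym (vars-decode-encode rest)) p∈V′))
    where
    p∈V′ : p ∈ V without leaf
    p∈V′ = ∈-without⁺ leaf (∈-resp-↭ vars↭ (parent∈vars t edge)) parent≢leaf
  ... | no c≢l  = edges-insertLeaf⁺ p leaf D (proj₂ IH (edges-removeLeaf⊇ leaf t e∈ c≢l))

-- Recovering a term from its edges

Increasing : List ℕ → Set
Increasing = AllPairs _<_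

restrict-⊆ᴱ : ∀ {s₁ t₁ s₂ t₂} → Linear (s₁ · t₁) → vars s₁ ≡ vars s₂ → vars t₁ ≡ vars t₂ →
              (s₁ · t₁) ⊆ᴱ (s₂ · t₂) → s₁ ⊆ᴱ s₂ × t₁ ⊆ᴱ t₂
restrict-⊆ᴱ {s₁} {t₁} {s₂} {t₂} lin vs≡ vt≡ ⊆ = left , right
  where
  apart : ∀ {v} {A : Set} → v ∈ vars s₁ → v ∈ vars t₁ → A
  apart v∈s v∈t = ⊥-elim (Linear-·-disjoint s₁ t₁ lin v∈s v∈t)
  left : s₁ ⊆ᴱ s₂
  left e∈ with ⊆ (there (∈-++⁺ˡ e∈))
  ... | here refl = apart (child∈vars s₁ e∈) (subst (root t₂ ∈_) (sym vt≡) (root∈vars t₂))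
  ... | there e∈′ with ∈-++⁻ (edges s₂) e∈′
  ...   | inj₁ e∈s₂ = e∈s₂
  ...   | inj₂ e∈t₂ = apart (child∈vars s₁ e∈) (subst (_ ∈_) (sym vt≡) (child∈vars t₂ e∈t₂))
  right : t₁ ⊆ᴱ t₂
  right e∈ with ⊆ (there (∈-++⁺ʳ (edges s₁) e∈))
  ... | here refl = apart (subst (root s₂ ∈_) (sym vs≡) (root∈vars s₂)) (parent∈vars t₁ e∈)
  ... | there e∈′ with ∈-++⁻ (edges s₂) e∈′
  ...   | inj₁ e∈s₂ = apart (subst (_ ∈_) (sym vs≡) (child∈vars s₂ e∈s₂)) (child∈vars t₁ e∈)
  ...   | inj₂ e∈t₂ = e∈t₂

right-root-≡-or-∈-left : ∀ {s₁ t₁ s₂ t₂} → Linear (s₂ · t₂) → root s₁ ≡ root s₂ → (s₁ · t₁) ⊆ᴱ (s₂ · t₂) →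
             root t₁ ≡ root t₂ ⊎ root t₁ ∈ vars s₂
right-root-≡-or-∈-left {s₁} {t₁} {s₂} {t₂} lin rs≡ ⊆ with ⊆ (here refl)
... | here e = inj₁ (cong proj₁ e)
... | there e∈ with ∈-++⁻ (edges s₂) e∈
...   | inj₁ e∈s₂ = inj₂ (child∈vars s₂ e∈s₂)
...   | inj₂ e∈t₂ = ⊥-elim (Linear-·-disjoint s₂ t₂ lin (subst (_∈ vars s₂) (sym rs≡) (root∈vars s₂)) (parent∈vars t₂ e∈t₂))

Increasing-SameEdges⇒≡ : ∀ s t → Increasing (vars s) → vars s ≡ vars t → SameEdges s t → s ≡ t
Increasing-SameEdges⇒≡ (var i) (var j) _ refl _ = refl
Increasing-SameEdges⇒≡ (var i) (s · t) _ vs≡ _ with () ← trans (cong length vs≡) (length-vars (s · t))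
Increasing-SameEdges⇒≡ (s · t) (var j) _ vs≡ _ with () ← trans (cong length (sym vs≡)) (length-vars (s · t))
Increasing-SameEdges⇒≡ (s₁ · t₁) (s₂ · t₂) inc vs≡ (⊆ , ⊇) =
  cong₂ _·_ (Increasing-SameEdges⇒≡ s₁ s₂ inc-s₁ vs₁≡ (proj₁ sides⊆ , proj₁ sides⊇))
            (Increasing-SameEdges⇒≡ t₁ t₂ inc-t₁ vt₁≡ (proj₂ sides⊆ , proj₂ sides⊇))
  where
  inc₂ = subst Increasing vs≡ inc
  lin₁ : Linear (s₁ · t₁)
  lin₁ = AllPairs.map (λ x<y x≡y → <-irrefl x≡y x<y) inc
  lin₂ : Linear (s₂ · t₂)
  lin₂ = subst Unique vs≡ lin₁
  split₁ = AllPairs-++⁻ (vars s₁) inc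
  split₂ = AllPairs-++⁻ (vars s₂) inc₂
  inc-s₁ = proj₁ split₁
  inc-t₁ = proj₁ (proj₂ split₁)

  roots-s : root s₁ ≡ root s₂
  roots-s with xs₁ , e₁ ← vars-root∷ s₁ | xs₂ , e₂ ← vars-root∷ s₂ =
    ∷-injectiveˡ (trans (cong (_++ vars t₁) (sym e₁)) (trans vs≡ (cong (_++ vars t₂) e₂)))

  roots-t : root t₁ ≡ root t₂
  roots-t with right-root-≡-or-∈-left {s₁} {t₁} {s₂} {t₂} lin₂ roots-s ⊆ | right-root-≡-or-∈-left {s₂} {t₂} {s₁} {t₁} lin₁ (sym roots-s) ⊇
  ... | inj₁ eq    | _           = eq
  ... | inj₂ _     | inj₁ eq     = sym eq
  ... | inj₂ t₁∈s₂ | inj₂ t₂∈s₁  =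
    ⊥-elim (<-asym (proj₂ (proj₂ split₂) t₁∈s₂ (root∈vars t₂)) (proj₂ (proj₂ split₁) t₂∈s₁ (root∈vars t₁)))

  vars-split : vars s₁ ≡ vars s₂ × vars t₁ ≡ vars t₂
  vars-split with xs₁ , e₁ ← vars-root∷ t₁ | xs₂ , e₂ ← vars-root∷ t₂ =
    let vs≡′ = trans (cong (vars s₁ ++_) (sym e₁)) (trans vs≡ (cong (vars s₂ ++_) (trans e₂ (cong (_∷ xs₂) (sym roots-t)))))
        prefix≡ , suffix≡ = ++-cancel-at (vars s₁) (vars s₂) vs≡′
                              (λ r∈ → Linear-·-disjoint s₁ t₁ lin₁ r∈ (root∈vars t₁))
                              (λ r∈ → Linear-·-disjoint s₂ t₂ lin₂ r∈ (subst (_∈ vars t₂) (sym roots-t) (root∈vars t₂)))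
    in prefix≡ , trans e₁ (trans (cong₂ _∷_ roots-t suffix≡) (sym e₂))
  vs₁≡ = proj₁ vars-split
  vt₁≡ = proj₂ vars-split

  sides⊆ = restrict-⊆ᴱ {s₁} {t₁} {s₂} {t₂} lin₁ vs₁≡ vt₁≡ ⊆
  sides⊇ = restrict-⊆ᴱ {s₂} {t₂} {s₁} {t₁} lin₂ (sym vs₁≡) (sym vt₁≡) ⊇

-- Counting term operations

Spans-FullLinear : ∀ {m t} → FullLinear (suc m) t → Spans m (upTo (suc m)) t
Spans-FullLinear {m} {t} fl = record { unique = Unique.upTo⁺ (suc m) ; vars↭ = fl ; length≡ = length-upTo (suc m) }

Increasing-upTo : ∀ n → Increasing (upTo n)
Increasing-upTo n = AllPairs.applyUpTo⁺₁ (λ x → x) n (λ i<j _ → i<j)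

encode-injective-on-bracketings : ∀ {m b₁ b₂} → Bracketing (suc m) b₁ → Bracketing (suc m) b₂ →
  encode m (upTo (suc m)) b₁ ≡ encode m (upTo (suc m)) b₂ → b₁ ≡ b₂
encode-injective-on-bracketings {m} {b₁} {b₂} br₁ br₂ codes≡ =
  Increasing-SameEdges⇒≡ b₁ b₂ (subst Increasing (sym br₁) (Increasing-upTo (suc m))) (trans br₁ (sym br₂))
    ((λ e∈ → proj₁ same₂ (subst (λ c → _ ∈ edges (decode V c)) codes≡ (proj₂ same₁ e∈))) ,
     (λ e∈ → proj₁ same₁ (subst (λ c → _ ∈ edges (decode V c)) (sym codes≡) (proj₂ same₂ e∈))))
  where
  V = upTo (suc m)
  same₁ = edges-decode-encode (Spans-FullLinear {m} (↭-reflexive br₁))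
  same₂ = edges-decode-encode (Spans-FullLinear {m} (↭-reflexive br₂))

module Counting {c ℓ : Level} (G : Magma c ℓ) (right-perm : RightPermutable G) where
  open Magma G using () renaming (refl to ≈-refl; sym to ≈-sym; trans to ≈-trans)
  open LeafSemantics G right-perm

  ≈ᵒᵖ-setoid : Setoid 0ℓ (c ⊔ ℓ)
  ≈ᵒᵖ-setoid = record
    { Carrier = Term
    ; _≈_ = _≈ᵒᵖ_ G
    ; isEquivalence = record
      { refl = λ ρ → ≈-refl ; sym = λ s≈t ρ → ≈-sym (s≈t ρ) ; trans = λ s≈t t≈u ρ → ≈-trans (s≈t ρ) (t≈u ρ) } }

  open Setoid ≈ᵒᵖ-setoid using () renaming (_≈_ to _≈ₜ_; refl to ≈ₜ-refl)
  open SetoidReasoning ≈ᵒᵖ-setoid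

  ExactlyOps⇒≤ : ∀ {K K′ Q} → ExactlyOps G K Q → AtMostOps G K′ Q → K ≤ K′
  ExactlyOps⇒≤ (L , len-L , L⊆Q , apart , _) (R , len-R , _ , R-covers) =
    ≤-trans (≤-reflexive (sym len-L))
      (≤-trans (pairwise-distinct-covered⇒length≤ ≈ᵒᵖ-setoid L R apart (All.map (R-covers _) L⊆Q)) len-R)

  ≈decode-encode : ∀ {k V t} → Spans k V t → t ≈ₜ decode V (encode k V t)
  ≈decode-encode {zero}  {V} {t} sp = ≡⇒≈ᵒᵖ (sym (decode-encode-zero sp))
  ≈decode-encode {suc k} {V} {t} sp = begin
    t                                                ≈⟨ ≈insertLeaf-removeLeaf t leaf p (Spans.linear sp) ≢root (proj₂ isLeaf) edge ⟩
    insertLeaf p leaf t′                             ≈⟨ insertLeaf-cong p leaf {t′} {decode V′ (encode k V′ t′)} (≈decode-encode rest) ⟩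
    insertLeaf p leaf (decode V′ (encode k V′ t′))  ≡⟨ decode-encode-suc sp ⟨
    decode V (encode (suc k) V t)                    ∎
    where
    open FirstLeaf (firstLeaf sp)
    p = parent t leaf
    V′ = V without leaf
    t′ = removeLeaf leaf t

  module _ (m : ℕ) where
    private
      V = upTo (suc m)
      IsWord : List ℕ → Set
      IsWord w = length w ≡ m × All (_∈ V) w

    decodings-atMost : ∀ {K} (W : List (List ℕ)) → length W ≤ K → All IsWord W →
                       (∀ t → FullLinear (suc m) t → Any (λ w → t ≈ₜ decode V w) W) →
                       AtMostOps G K (FullLinear (suc m))
    decodings-atMost W len≤ W-words covers =
      map (decode V) W ,
      ≤-trans (≤-reflexive (length-map (decode V) W)) len≤ ,
      All.map⁺ (All.map (λ (len , w⊆V) → vars-decode V _ (Unique.upTo⁺ (suc m)) (trans (length-upTo (suc m)) (cong suc (sym len))) w⊆V) W-words) ,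
      (λ t fl → Any.map⁺ (covers t fl))

    encode∈words : ∀ t → FullLinear (suc m) t → encode m V t ∈ words m V
    encode∈words t fl = words-complete m V _ C.length≡ C.⊆V
      where module C = IsPrüferCode (encode-spec (Spans-FullLinear {m} {t} fl))

    atMostOps : AtMostOps G (suc m ^ m) (FullLinear (suc m))
    atMostOps = decodings-atMost (words m V) (≤-reflexive (trans (length-words m V) (cong (_^ m) (length-upTo (suc m)))))
      (words-sound m V)
      (λ t fl → lose (encode∈words t fl) (≈decode-encode (Spans-FullLinear {m} {t} fl)))

    bracketings-apart : ExactlyOps G (suc m ^ m) (FullLinear (suc m)) →
                        ∀ {b₁ b₂} → Bracketing (suc m) b₁ → Bracketing (suc m) b₂ → b₁ ≢ b₂ → ¬ b₁ ≈ₜ b₂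
    bracketings-apart exactly {b₁} {b₂} br₁ br₂ b₁≢b₂ b₁≈b₂ =
      <-irrefl refl (<-≤-trans fewer (ExactlyOps⇒≤ exactly (decodings-atMost W ≤-refl W-words covers)))
      where
      sp₁ = Spans-FullLinear {m} {b₁} (↭-reflexive br₁)
      sp₂ = Spans-FullLinear {m} {b₂} (↭-reflexive br₂)
      c₁ = encode m V b₁
      c₂ = encode m V b₂
      c₁≢c₂ : c₁ ≢ c₂
      c₁≢c₂ = b₁≢b₂ ∘ encode-injective-on-bracketings br₁ br₂
      ≢c₂? = λ w → ¬? (≡-dec _≟_ w c₂)
      W = filter ≢c₂? (words m V)
      W-words = All.filter⁺ ≢c₂? (words-sound m V)
      fewer : length W < suc m ^ m
      fewer = <-≤-trans (filter-notAll ≢c₂? (words m V) (lose (encode∈words b₂ (↭-reflexive br₂)) (λ c₂≢c₂ → c₂≢c₂ refl)))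
                        (≤-reflexive (trans (length-words m V) (cong (_^ m) (length-upTo (suc m)))))
      covers : ∀ t → FullLinear (suc m) t → Any (λ w → t ≈ₜ decode V w) W
      covers t fl with ≡-dec _≟_ (encode m V t) c₂
      ... | no  ≢c₂ = lose (∈-filter⁺ ≢c₂? (encode∈words t fl) ≢c₂) (≈decode-encode (Spans-FullLinear {m} {t} fl))
      ... | yes ≡c₂ = lose (∈-filter⁺ ≢c₂? (encode∈words b₁ (↭-reflexive br₁)) c₁≢c₂) (begin
        t                       ≈⟨ ≈decode-encode (Spans-FullLinear {m} {t} fl) ⟩
        decode V (encode m V t) ≡⟨ cong (decode V) ≡c₂ ⟩
        decode V c₂             ≈⟨ ≈decode-encode sp₂ ⟨
        b₂                      ≈⟨ b₁≈b₂ ⟨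
        b₁                      ≈⟨ ≈decode-encode sp₁ ⟩
        decode V c₁             ∎)

    exactlyOps : ExactlyOps G (suc m ^ m) (FullLinear (suc m)) → ExactlyOps G (Catalan m) (Bracketing (suc m))
    exactlyOps exactly =
      bracketings m , length-bracketings m , bracketings-sound m ,
      AllPairs-map-on (bracketings-apart exactly) (bracketings-sound m) (bracketings-unique m) ,
      (λ t br → lose (bracketings-complete m t br) (≈ₜ-refl {t}))

proposition6p4 : ∀ {c ℓ : Level} (G : Magma c ℓ) → RightPermutable G →
    (∀ s t → Linear s → Linear t → P s ≅ᵘ P t → _≈ᵒᵖ_ G s t)
    × (∀ m → AtMostOps G (suc m ^ m) (FullLinear (suc m)))
    × (∀ m → ExactlyOps G (suc m ^ m) (FullLinear (suc m))
           → ExactlyOps G (Catalan m) (Bracketing (suc m)))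
proposition6p4 G right-perm = (λ s t _ _ → ≅ᵘ⇒≈ᵒᵖ s t) , atMostOps , exactlyOps
  where
  open TreeEvaluation G right-perm
  open Counting G right-perm
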